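{- Let $k$ be a field and let $\Sigma$ be a finite oriented signed graph on vertex set $V=[n]$ (multiple edges, loops and half-edges allowed), with bidirection $\tau$. Let $S_\Sigma=k[U_e : e \text{ an edge of }\Sigma]$ and let $\phi\colon S_\Sigma\to k[t_1^{\pm1},\dots,t_n^{\pm1}]$ be the $k$-algebra map with $\phi(U_e)=t_i^{\tau(i,e)}t_j^{\tau(j,e)}$ if $e$ has ends $i,j$ (with $i=j$ allowed for a loop, so a loop with equal incidence signs $\delta,\delta$ maps to $t_i^{2\delta}$ and a loop with opposite incidence signs maps to $1$), and $\phi(U_e)=t_i^{\tau(i,e)}$ if $e$ is a half-edge at $i$. Then the toric ideal $I_\Sigma=\ker\phi$ is generated by the cycle binomials $$U(C)=\prod_{e\in W(C)}U_{\pi(e)}-\prod_{e\in A(C)}U_{\pi(e)},$$ where $C$ runs over the cycles of the signed covering $\widetilde\Sigma$ that are not fixed orientation-wise by the involution $\iota$.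
   Context: An oriented signed graph is a graph $\Gamma$ with a sign $\sigma(e)\in\{\pm\}$ on each edge and a bidirection $\tau$ assigning a sign $\tau(v,e)\in\{\pm1\}$ to each incidence of a vertex $v$ with an edge $e$, compatible in the sense $\sigma(e)=-\tau(v,e)\tau(w,e)$ for an edge with ends $v,w$ (a half-edge has a single incidence). The signed covering $\widetilde\Sigma$ is the directed (multi)graph on vertex set $\{\pm1,\dots,\pm n\}\cup\{0\}$ obtained as follows: an edge $e$ of $\Sigma$ with ends $i\neq j$ and incidence signs $\delta=\tau(i,e)$, $\epsilon=\tau(j,e)$ gives the two directed edges $\delta i\to-\epsilon j$ and $\epsilon j\to -\delta i$; a loop at $i$ with both incidence signs $\delta$ gives the single directed edge $\delta i\to-\delta i$; a loop at $i$ with opposite incidence signs gives a self-loop at $i$ and a self-loop at $-i$; a half-edge at $i$ with incidence sign $\delta$ gives the directed edges $\delta i\to 0$ and $0\to-\delta i$. For an edge $e$ of $\widetilde\Sigma$, $\pi(e)$ denotes the edge of $\Sigma$ it comes from. The involution $\iota$ of $\widetilde\Sigma$ sends vertex $v$ to $-v$ (fixing $0$) and sends each directed edge $x\to y$ to the directed edge $-y\to-x$ coming from the same edge of $\Sigma$ (so $\iota$ swaps the two edges arising from one edge of $\Sigma$). A cycle $C$ of $\widetilde\Sigma$ is a cycle of the underlying undirected multigraph (a self-loop is a cycle of length one); choosing a direction of traversal, $W(C)$ is the set of edges of $C$ traversed along their direction and $A(C)$ the set traversed against it. $\iota(C)$ is given the traversal induced by applying $\iota$ to the traversal of $C$. $C$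 is fixed orientation-wise by $\iota$ if $\iota(C)=C$ as sets of edges and $W(\iota(C))=W(C)$ (hence $A(\iota(C))=A(C)$). -}

module Defs where

open import Level using (Level; _⊔_)
open import Algebra.Bundles using (CommutativeRing)
open import Data.Bool using (Bool; true; false; not; _∧_; if_then_else_)
open import Data.Nat as ℕ using (ℕ; zero; suc; s≤s)
open import Data.Nat.Properties as ℕP using ()
open import Data.Integer as ℤ using (ℤ)
open import Data.Sign using (Sign; opposite) renaming (+ to pos; - to neg)
import Data.Sign.Properties as SignP
open import Data.Fin as Fin using (Fin; toℕ; fromℕ<)
import Data.Fin.Properties as FinP
open import Data.Vec as Vec using (Vec; tabulate; zipWith)
import Data.Vec.Properties as VecP
open import Data.List as List using (List; []; _∷_; foldr; concatMap; allFin)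
open import Data.Nat.ListAction using (sum)
open import Data.Maybe using (Maybe; just; nothing)
open import Data.Product using (Σ; ∃; _×_; _,_; proj₁; proj₂)
open import Data.Unit using (⊤)
open import Relation.Nullary using (¬_; yes; no; Dec)
open import Relation.Nullary.Decidable using (⌊_⌋)
open import Relation.Binary.PropositionalEquality using (_≡_)
open import Function.Bundles using (_⇔_)

record Field (c ℓ : Level) : Set (Level.suc (c ⊔ ℓ)) where
  field
    commutativeRing : CommutativeRing c ℓ
  open CommutativeRing commutativeRing public
  field
    1≉0     : ¬ (1# ≈ 0#)
    inverse : ∀ x → ¬ (x ≈ 0#) → ∃ λ y → (x * y) ≈ 1#

-- An edge is either an edge with ends i, j (i = j allowed: a loop)
-- together with the incidence signs τ(i,e), τ(j,e), or a half-edge at i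
-- with incidence sign τ(i,e).  The edge sign σ(e) = -τ(i,e)τ(j,e) is
-- determined by τ and therefore not stored.

data SEdge (n : ℕ) : Set where
  link : (i : Fin n) (δ : Sign) (j : Fin n) (ε : Sign) → SEdge n
  half : (i : Fin n) (δ : Sign) → SEdge n

SGraph : ℕ → ℕ → Set
SGraph n m = Fin m → SEdge n

signℤ : Sign → ℤ
signℤ pos = ℤ.+ 1
signℤ neg = ℤ.- (ℤ.+ 1)

isEqLoop : ∀ {n} → SEdge n → Bool
isEqLoop (link i δ j ε) = ⌊ i Fin.≟ j ⌋ ∧ ⌊ δ SignP.≟ ε ⌋
isEqLoop (half i δ)     = false

-- The signed covering Σ̃.
-- Vertices: nothing = 0, just (s , i) = s·i  (s ∈ {±}, i ∈ [n]).

CVert : ℕ → Set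
CVert n = Maybe (Sign × Fin n)

cvneg : ∀ {n} → CVert n → CVert n
cvneg nothing        = nothing
cvneg (just (s , i)) = just (opposite s , i)

-- Candidate edges of Σ̃: (e , b) with e an edge of Σ and b a copy flag.
-- Every edge of Σ gives two copies, except a loop with equal incidence
-- signs, which gives only the copy b = true.
CEdge : ℕ → Set
CEdge m = Fin m × Bool

module Covering {n m : ℕ} (G : SGraph n m) where

  present : CEdge m → Bool
  present (e , true)  = true
  present (e , false) = not (isEqLoop (G e))

  src tgt : CEdge m → CVert n
  src (e , b) with G e | b
  ... | link i δ j ε | true  = just (δ , i)
  ... | link i δ j ε | false = just (ε , j)
  ... | half i δ     | true  = just (δ , i)
  ... | half i δ     | false = nothing
  tgt (e , b) with G e | b
  ... | link i δ j ε | true  = just (opposite ε , j)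
  ... | link i δ j ε | false = just (opposite δ , i)
  ... | half i δ     | true  = nothing
  ... | half i δ     | false = just (opposite δ , i)

  π : CEdge m → Fin m
  π = proj₁

  ι : CEdge m → CEdge m
  ι (e , b) = if isEqLoop (G e) then (e , b) else (e , not b)

  next : ∀ {l} → Fin (suc l) → Fin (suc l)
  next {l} k with toℕ k ℕ.<? l
  ... | yes p = fromℕ< (s≤s p)
  ... | no _  = Fin.zero

  -- A cycle of the underlying undirected multigraph of Σ̃ together with
  -- a direction of traversal: steps k = 0..l, step k uses covering edge
  -- edge k, traversed along its direction iff fwd k ≡ true.
  stepFrom stepTo : CEdge m → Bool → CVert n
  stepFrom c f = if f then src c else tgt c
  stepTo   c f = if f then tgt c else src c

  record Cycle : Set where
    field
      l     : ℕ
      edge  : Fin (suc l) → CEdge m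
      fwd   : Fin (suc l) → Bool
      edges-present : ∀ k → present (edge k) ≡ true
      closed        : ∀ k → stepTo (edge k) (fwd k) ≡ stepFrom (edge (next k)) (fwd (next k))
      vertices-distinct : ∀ k k′ → stepFrom (edge k) (fwd k) ≡ stepFrom (edge k′) (fwd k′) → k ≡ k′
      edges-distinct    : ∀ k k′ → edge k ≡ edge k′ → k ≡ k′

  _∈E_ : CEdge m → Cycle → Set
  c ∈E C = ∃ λ k → Cycle.edge C k ≡ c
  _∈W_ : CEdge m → Cycle → Set
  c ∈W C = ∃ λ k → (Cycle.edge C k ≡ c) × (Cycle.fwd C k ≡ true)
  _∈A_ : CEdge m → Cycle → Set
  c ∈A C = ∃ λ k → (Cycle.edge C k ≡ c) × (Cycle.fwd C k ≡ false)

  -- C is fixed orientation-wise by ι: ι(C) = C as edge sets and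
  -- W(ι(C)) = W(C).  With the induced traversal, W(ι(C)) = ι(A(C)),
  -- so c ∈ W(ι(C)) iff ι c ∈ A(C) (ι is an involution).
  FixedOrientationwise : Cycle → Set
  FixedOrientationwise C =
    (∀ c → (c ∈E C) ⇔ (ι c ∈E C)) × (∀ c → (c ∈W C) ⇔ (ι c ∈A C))

  expOf : (C : Cycle) → Bool → Vec ℕ m
  expOf C b = tabulate λ e →
    sum (List.map (λ k → if ⌊ π (Cycle.edge C k) Fin.≟ e ⌋ ∧ ⌊ Cycle.fwd C k Data.Bool.≟ b ⌋
                          then 1 else 0)
                  (allFin (suc (Cycle.l C))))
    where import Data.Bool

-- Polynomials over a field, as finite formal sums of terms c·x^u,
-- with equality given by equality of all coefficients.

module Polys {c ℓ : Level} (K : Field c ℓ) where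
  open Field K

  Poly : ℕ → Set c
  Poly m = List (Carrier × Vec ℕ m)

  LPoly : ℕ → Set c
  LPoly n = List (Carrier × Vec ℤ n)

  coeff : ∀ {m} → Poly m → Vec ℕ m → Carrier
  coeff p u = foldr (λ t acc → if ⌊ VecP.≡-dec ℕP._≟_ (proj₂ t) u ⌋ then proj₁ t + acc else acc) 0# p

  lcoeff : ∀ {n} → LPoly n → Vec ℤ n → Carrier
  lcoeff p u = foldr (λ t acc → if ⌊ VecP.≡-dec ℤ._≟_ (proj₂ t) u ⌋ then proj₁ t + acc else acc) 0# p

  _≈P_ : ∀ {m} → Poly m → Poly m → Set ℓ
  p ≈P q = ∀ u → coeff p u ≈ coeff q u

  _≈L_ : ∀ {n} → LPoly n → LPoly n → Set ℓ
  p ≈L q = ∀ u → lcoeff p u ≈ lcoeff q u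

  0P : ∀ {m} → Poly m
  0P = []

  0L : ∀ {n} → LPoly n
  0L = []

  _+P_ : ∀ {m} → Poly m → Poly m → Poly m
  p +P q = p List.++ q

  _*P_ : ∀ {m} → Poly m → Poly m → Poly m
  p *P q = concatMap (λ s → List.map (λ t → (proj₁ s * proj₁ t , zipWith ℕ._+_ (proj₂ s) (proj₂ t))) q) p

  binomial : ∀ {m} → Vec ℕ m → Vec ℕ m → Poly m
  binomial u v = (1# , u) ∷ (- 1# , v) ∷ []

  InIdeal : ∀ {m} {a} (G : Poly m → Set a) → Poly m → Set (c ⊔ ℓ ⊔ a)
  InIdeal {m} G f = ∃ λ (hs : List (Poly m × Σ (Poly m) G)) →
    f ≈P foldr (λ hg acc → (proj₁ hg *P proj₁ (proj₂ hg)) +P acc) 0P hs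

module Toric {c ℓ : Level} (K : Field c ℓ) {n m : ℕ} (G : SGraph n m) where
  open Field K
  open Polys K
  open Covering G

  unitℤ : Fin n → Sign → Vec ℤ n
  unitℤ i δ = tabulate λ k → if ⌊ k Fin.≟ i ⌋ then signℤ δ else ℤ.+ 0

  φexp : Fin m → Vec ℤ n
  φexp e with G e
  ... | link i δ j ε = zipWith ℤ._+_ (unitℤ i δ) (unitℤ j ε)
  ... | half i δ     = unitℤ i δ

  φmono : Vec ℕ m → Vec ℤ n
  φmono u = foldr (λ e acc → zipWith ℤ._+_
                      (Vec.map (λ z → ℤ.+ (Vec.lookup u e) ℤ.* z) (φexp e)) acc)
                  (Vec.replicate n (ℤ.+ 0)) (allFin m)

  φ : Poly m → LPoly n
  φ = List.map (λ t → (proj₁ t , φmono (proj₂ t)))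

  InToricIdeal : Poly m → Set ℓ
  InToricIdeal f = φ f ≈L 0L

  U : Cycle → Poly m
  U C = binomial (expOf C true) (expOf C false)

  CycleBinomial : Poly m → Set ℓ
  CycleBinomial g = ∃ λ (C : Cycle) → (¬ FixedOrientationwise C) × (g ≈P U C)

module Submission where

-- Let T be the potential on the vertices of the signed covering Σ̃ given by T(±i) = ±eᵢ and T(0) = 0.
-- For every edge c of Σ̃ the exponent vector of φ(U_π(c)) is T(src c) - T(tgt c), so around a cycle the
-- forward and the backward edges have the same total exponent: every U(C) lies in ker φ.
--
-- Conversely, grouping the terms of f ∈ ker φ by φ-fibre writes f as a combination of binomials
-- x^u - x^v with φ(x^u) = φ(x^v), and these are reduced by induction on the degree. A common variable of
-- x^u and x^v is factored out. Otherwise walk in Σ̃, using the edges of u forwards and those of v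
-- backwards. The unused parts u′, v′ satisfy φ(x^u′) - φ(x^v′) = T(end) - T(start) (as exponents), and a
-- nonzero gap T(end) - T(start) always exhibits an unused edge leaving the end vertex, so the walk goes on
-- until it revisits a vertex and closes a cycle C with W(C) ≤ u and A(C) ≤ v. Since u and v have disjoint
-- supports, ι does not fix C, and x^u - x^v = x^(u-W(C))·U(C) + (x^(u-W(C)+A(C)) - x^v), where the last
-- binomial has smaller degree.

open import Defs
open import Level using (Level)
open import Algebra.Bundles using (CommutativeRing; Semiring)
import Algebra.Properties.CommutativeSemigroup as CommutativeSemigroupProperties
import Algebra.Properties.Ring as RingProperties
import Algebra.Properties.Semiring.Sum as SemiringSum
open import Data.Bool as Bool using (Bool; true; false; not; _∧_; if_then_else_)
import Data.Bool.Properties as Boolₚ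
open import Data.Empty using (⊥; ⊥-elim)
open import Data.Fin as Fin using (Fin; toℕ; fromℕ; inject₁)
import Data.Fin.Properties as Finₚ
open import Data.Integer as ℤ using (ℤ; +_; 0ℤ)
import Data.Integer.Properties as ℤₚ
open import Data.Integer.Tactic.RingSolver using (solve-∀)
open import Data.List as List using (List; []; _∷_; _++_; allFin; foldr)
open import Data.List.Membership.Propositional using (_∈_)
open import Data.List.Membership.Propositional.Properties using (∈-lookup; ∈-map⁺; ∈-++⁺ˡ; ∈-++⁺ʳ; ∈-deduplicate⁺)
import Data.List.Properties as Listₚ
open import Data.List.Relation.Binary.Pointwise using (Pointwise; []; _∷_)
open import Data.List.Relation.Unary.All as All using (All; []; _∷_)
open import Data.List.Relation.Unary.AllPairs using (_∷_)
open import Data.List.Relation.Unary.Any using (here; there)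
open import Data.List.Relation.Unary.Unique.DecPropositional.Properties using (deduplicate-!)
open import Data.List.Relation.Unary.Unique.Propositional using (Unique)
open import Data.Maybe using (Maybe; just; nothing; fromMaybe)
import Data.Maybe.Properties as Maybeₚ
open import Data.Nat as ℕ using (ℕ; zero; suc; _≤_; _<_; z≤n; s≤s)
open import Data.Nat.ListAction using () renaming (sum to sumᴸ)
import Data.Nat.Properties as ℕₚ
open import Data.Product using (Σ; ∃; _×_; _,_; proj₁; proj₂)
import Data.Product.Properties as Productₚ
open import Data.Sign using (opposite) renaming (+ to pos; - to neg)
import Data.Sign.Properties as Signₚ
open import Data.Sum using (_⊎_; inj₁; inj₂)
open import Data.Unit using (⊤; tt)
open import Data.Vec as Vec using (Vec; lookup; zipWith)
import Data.Vec.Properties as Vecₚ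
open import Function using (_∘_; case_of_)
open import Function.Bundles using (_⇔_; mk⇔; Equivalence)
open import Relation.Binary.Definitions using (DecidableEquality)
open import Relation.Binary.PropositionalEquality as ≡
  using (_≡_; _≢_; refl; sym; trans; cong; cong₂; subst; subst₂; module ≡-Reasoning)
import Relation.Binary.Reasoning.Setoid as SetoidReasoning
open import Relation.Nullary using (¬_; yes; no; Dec; _×-dec_; _⊎-dec_)
open import Relation.Nullary.Decidable using (⌊_⌋; ⌊⌋-map′; isYes≗does; does-⇔)

open import Algebra.Properties.AbelianGroup ℤₚ.+-0-abelianGroup using () renaming (∙-cancelʳ to +-cancelʳ)

module ∑ℤ = SemiringSum ℤₚ.+-*-semiring
module ∑ℕ = SemiringSum ℕₚ.+-*-semiring

module _ {c ℓ} (R : Semiring c ℓ) where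
  open Semiring R using (Carrier; _≈_; 0#; reflexive; +-congˡ; +-identityˡ; +-identityʳ) renaming (trans to ≈-trans)
  open SemiringSum R using (sum; sum-cong-≗; sum-replicate-zero)

  sum-indicator : ∀ {k} (i : Fin k) (g : Fin k → Carrier) →
                  sum (λ j → if ⌊ i Fin.≟ j ⌋ then g j else 0#) ≈ g i
  sum-indicator {suc k} Fin.zero    g = ≈-trans (+-congˡ (sum-replicate-zero k)) (+-identityʳ (g Fin.zero))
  sum-indicator {suc k} (Fin.suc i) g =
    ≈-trans (+-identityˡ _)
      (≈-trans (reflexive (sum-cong-≗ λ j → cong (λ b → if b then g (Fin.suc j) else 0#) (⌊⌋-map′ _ _ (i Fin.≟ j))))
               (sum-indicator i (g ∘ Fin.suc)))

sum-map-allFin : ∀ {k} (f : Fin k → ℕ) → sumᴸ (List.map f (allFin k)) ≡ ∑ℕ.sum f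
sum-map-allFin {k} f = trans (cong sumᴸ (Listₚ.map-tabulate {n = k} (λ i → i) f)) (sum-tabulate f)
  where
  sum-tabulate : ∀ {k} (f : Fin k → ℕ) → sumᴸ (List.tabulate f) ≡ ∑ℕ.sum f
  sum-tabulate {zero}  f = refl
  sum-tabulate {suc k} f = cong (f Fin.zero ℕ.+_) (sum-tabulate (f ∘ Fin.suc))

term≤∑ℕ : ∀ {k} (f : Fin k → ℕ) i → f i ≤ ∑ℕ.sum f
term≤∑ℕ f Fin.zero    = ℕₚ.m≤m+n _ _
term≤∑ℕ f (Fin.suc i) = ℕₚ.≤-trans (term≤∑ℕ (f ∘ Fin.suc) i) (ℕₚ.m≤n+m _ (f Fin.zero))

module _ where
  open import Data.Integer using (_+_; -_)

  ∑ℤ-neg : ∀ {k} (f : Fin k → ℤ) → ∑ℤ.sum (λ i → - f i) ≡ - ∑ℤ.sum f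
  ∑ℤ-neg {zero}  f = refl
  ∑ℤ-neg {suc k} f = trans (cong (_+_ (- f Fin.zero)) (∑ℤ-neg (f ∘ Fin.suc)))
                           (sym (ℤₚ.neg-distrib-+ (f Fin.zero) _))

  +-∑ℕ : ∀ {k} (f : Fin k → ℕ) → + ∑ℕ.sum f ≡ ∑ℤ.sum (λ i → + f i)
  +-∑ℕ {zero}  f = refl
  +-∑ℕ {suc k} f = trans (ℤₚ.pos-+ (f Fin.zero) _) (cong (_+_ (+ f Fin.zero)) (+-∑ℕ (f ∘ Fin.suc)))

  positive-summand : ∀ x y → 0ℤ ℤ.< x + y → ¬ (0ℤ ℤ.< x) → 0ℤ ℤ.< y
  positive-summand x y x+y>0 x≯0 =
    ℤₚ.<-≤-trans x+y>0 (subst (x + y ℤ.≤_) (ℤₚ.+-identityˡ y) (ℤₚ.+-monoˡ-≤ y (ℤₚ.≮⇒≥ x≯0)))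

  negative-summand : ∀ x y → x + y ℤ.< 0ℤ → ¬ (x ℤ.< 0ℤ) → y ℤ.< 0ℤ
  negative-summand x y x+y<0 x≮0 =
    ℤₚ.≤-<-trans (subst (ℤ._≤ x + y) (ℤₚ.+-identityˡ y) (ℤₚ.+-monoˡ-≤ y (ℤₚ.≮⇒≥ x≮0))) x+y<0

  positive-term-∑ℤ : ∀ {k} (f : Fin k → ℤ) → 0ℤ ℤ.< ∑ℤ.sum f → ∃ λ i → 0ℤ ℤ.< f i
  positive-term-∑ℤ {zero}  f (ℤ.+<+ ())
  positive-term-∑ℤ {suc k} f sum>0 with 0ℤ ℤ.<? f Fin.zero
  ... | yes f₀>0 = Fin.zero , f₀>0
  ... | no  f₀≯0 with positive-term-∑ℤ (f ∘ Fin.suc) (positive-summand (f Fin.zero) _ sum>0 f₀≯0)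
  ...   | i , fᵢ>0 = Fin.suc i , fᵢ>0

+*-positive : ∀ a y → 0ℤ ℤ.< + a ℤ.* y → 0 < a × 0ℤ ℤ.< y
+*-positive zero    y            (ℤ.+<+ ())
+*-positive (suc a) (+ zero)     a·y>0 = ⊥-elim (ℤₚ.<-irrefl refl (subst (0ℤ ℤ.<_) (ℤₚ.*-zeroʳ (+ suc a)) a·y>0))
+*-positive (suc a) ℤ.+[1+ y ]   _     = s≤s z≤n , ℤ.+<+ (s≤s z≤n)
+*-positive (suc a) ℤ.-[1+ y ]   ()

∑ℕ-snoc : ∀ L (f : ℕ → ℕ) → ∑ℕ.sum {suc L} (f ∘ toℕ) ≡ ∑ℕ.sum {L} (f ∘ toℕ) ℕ.+ f L
∑ℕ-snoc L f = trans (∑ℕ.sum-init-last {L} (f ∘ toℕ))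
                    (cong₂ ℕ._+_ (∑ℕ.sum-cong-≗ {L} (λ i → cong f (Finₚ.toℕ-inject₁ i))) (cong f (Finₚ.toℕ-fromℕ L)))

∑ℕ-cong-< : ∀ L {f g : ℕ → ℕ} → (∀ i → i < L → f i ≡ g i) → ∑ℕ.sum {L} (f ∘ toℕ) ≡ ∑ℕ.sum {L} (g ∘ toℕ)
∑ℕ-cong-< L f≡g = ∑ℕ.sum-cong-≗ (λ i → f≡g (toℕ i) (Finₚ.toℕ<n i))

∑ℕ-split : ∀ p k (f : ℕ → ℕ) →
           ∑ℕ.sum {p ℕ.+ k} (f ∘ toℕ) ≡ ∑ℕ.sum {p} (f ∘ toℕ) ℕ.+ ∑ℕ.sum {k} (λ i → f (p ℕ.+ toℕ i))
∑ℕ-split zero    k f = refl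
∑ℕ-split (suc p) k f =
  trans (cong (f 0 ℕ.+_) (∑ℕ-split p k (f ∘ suc)))
        (sym (ℕₚ.+-assoc (f 0) (∑ℕ.sum {p} (f ∘ suc ∘ toℕ)) (∑ℕ.sum {k} (λ i → f (suc p ℕ.+ toℕ i)))))

∑ℕ-segment : ∀ p k L (f : ℕ → ℕ) → p ℕ.+ k ≤ L → ∑ℕ.sum {k} (λ i → f (p ℕ.+ toℕ i)) ≤ ∑ℕ.sum {L} (f ∘ toℕ)
∑ℕ-segment p k L f p+k≤L with ℕₚ.m≤n⇒∃[o]m+o≡n p+k≤L
... | d , refl = begin
  ∑ℕ.sum {k} (λ i → f (p ℕ.+ toℕ i))                   ≤⟨ ℕₚ.m≤n+m _ _ ⟩
  ∑ℕ.sum {p} (f ∘ toℕ) ℕ.+ ∑ℕ.sum {k} (λ i → f (p ℕ.+ toℕ i)) ≡⟨ ∑ℕ-split p k f ⟨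
  ∑ℕ.sum {p ℕ.+ k} (f ∘ toℕ)                            ≤⟨ ℕₚ.m≤m+n _ _ ⟩
  ∑ℕ.sum {p ℕ.+ k} (f ∘ toℕ) ℕ.+ ∑ℕ.sum {d} (λ i → f (p ℕ.+ k ℕ.+ toℕ i)) ≡⟨ ∑ℕ-split (p ℕ.+ k) d f ⟨
  ∑ℕ.sum {p ℕ.+ k ℕ.+ d} (f ∘ toℕ)                     ∎
  where open ℕₚ.≤-Reasoning

lookup-ext : ∀ {a} {A : Set a} {k} {xs ys : Vec A k} → (∀ i → lookup xs i ≡ lookup ys i) → xs ≡ ys
lookup-ext {xs = xs} {ys} eq =
  trans (sym (Vecₚ.tabulate∘lookup xs)) (trans (Vecₚ.tabulate-cong eq) (Vecₚ.tabulate∘lookup ys))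

infixl 6 _⊕_
_⊕_ : ∀ {m} → Vec ℕ m → Vec ℕ m → Vec ℕ m
_⊕_ = zipWith ℕ._+_

lookup-⊕ : ∀ {m} (u v : Vec ℕ m) e → lookup (u ⊕ v) e ≡ lookup u e ℕ.+ lookup v e
lookup-⊕ u v e = Vecₚ.lookup-zipWith ℕ._+_ e u v

module _ where
  open import Data.Integer using (_+_)

  lookup-foldr-tabulate : ∀ {A : Set} {n k} (g : A → Vec ℤ n) (h : Fin k → A) r →
    lookup (foldr (λ a acc → zipWith _+_ (g a) acc) (Vec.replicate n 0ℤ) (List.tabulate h)) r
      ≡ ∑ℤ.sum (λ i → lookup (g (h i)) r)
  lookup-foldr-tabulate {k = zero}  g h r = Vecₚ.lookup-replicate r 0ℤ
  lookup-foldr-tabulate {k = suc k} g h r =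
    trans (Vecₚ.lookup-zipWith _+_ r (g (h Fin.zero)) _)
          (cong (_+_ (lookup (g (h Fin.zero)) r)) (lookup-foldr-tabulate g (h ∘ Fin.suc) r))

infixl 6 _⊖_
_⊖_ : ∀ {m} → Vec ℕ m → Vec ℕ m → Vec ℕ m
_⊖_ = zipWith ℕ._∸_

⊖-⊕ : ∀ {m} (u w : Vec ℕ m) → (∀ e → lookup w e ≤ lookup u e) → (u ⊖ w) ⊕ w ≡ u
⊖-⊕ u w w≤u = lookup-ext λ e →
  trans (lookup-⊕ (u ⊖ w) w e)
        (trans (cong (ℕ._+ lookup w e) (Vecₚ.lookup-zipWith ℕ._∸_ e u w)) (ℕₚ.m∸n+n≡m (w≤u e)))

⊕-comm : ∀ {m} (u v : Vec ℕ m) → u ⊕ v ≡ v ⊕ u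
⊕-comm = Vecₚ.zipWith-comm ℕₚ.+-comm

⊕-assoc : ∀ {m} (u v w : Vec ℕ m) → u ⊕ v ⊕ w ≡ u ⊕ (v ⊕ w)
⊕-assoc = Vecₚ.zipWith-assoc ℕₚ.+-assoc

degree : ∀ {m} → Vec ℕ m → ℕ
degree u = ∑ℕ.sum (lookup u)

degree-⊕ : ∀ {m} (u v : Vec ℕ m) → degree (u ⊕ v) ≡ degree u ℕ.+ degree v
degree-⊕ u v = trans (∑ℕ.sum-cong-≗ (lookup-⊕ u v)) (∑ℕ.∑-distrib-+ (lookup u) (lookup v))

unit : ∀ {m} → Fin m → Vec ℕ m
unit e = Vec.tabulate (λ e′ → if ⌊ e Fin.≟ e′ ⌋ then 1 else 0)

degree-unit : ∀ {m} (e : Fin m) → degree (unit e) ≡ 1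
degree-unit e = trans (∑ℕ.sum-cong-≗ (Vecₚ.lookup∘tabulate (λ e′ → if ⌊ e Fin.≟ e′ ⌋ then 1 else 0)))
                      (sum-indicator ℕₚ.+-*-semiring e (λ _ → 1))

unit≤ : ∀ {m} (u : Vec ℕ m) e → 0 < lookup u e → ∀ e′ → lookup (unit e) e′ ≤ lookup u e′
unit≤ u e u>0 e′ rewrite Vecₚ.lookup∘tabulate (λ e′ → if ⌊ e Fin.≟ e′ ⌋ then 1 else 0) e′ with e Fin.≟ e′
... | yes refl = u>0
... | no  _    = z≤n

degree-⊖-unit : ∀ {m} (a : Vec ℕ m) e → 0 < lookup a e → degree a ≡ suc (degree (a ⊖ unit e))
degree-⊖-unit a e a>0 = begin
  degree a                              ≡⟨ cong degree (⊖-⊕ a (unit e) (unit≤ a e a>0)) ⟨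
  degree (a ⊖ unit e ⊕ unit e)          ≡⟨ degree-⊕ (a ⊖ unit e) (unit e) ⟩
  degree (a ⊖ unit e) ℕ.+ degree (unit e) ≡⟨ cong (degree (a ⊖ unit e) ℕ.+_) (degree-unit e) ⟩
  degree (a ⊖ unit e) ℕ.+ 1             ≡⟨ ℕₚ.+-comm _ 1 ⟩
  suc (degree (a ⊖ unit e))             ∎
  where open ≡-Reasoning

degree-positive : ∀ {m} (a : Vec ℕ m) e → 0 < lookup a e → 0 < degree a
degree-positive a e a>0 = ℕₚ.<-≤-trans a>0 (term≤∑ℕ (lookup a) e)

⊕-regroup : ∀ {m} (a x y : Vec ℕ m) → a ⊕ (x ⊕ y) ≡ a ⊕ y ⊕ x
⊕-regroup a x y = trans (cong (a ⊕_) (⊕-comm x y)) (sym (⊕-assoc a y x))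

⊕-swap : ∀ {m} (a x y : Vec ℕ m) → a ⊕ x ⊕ y ≡ a ⊕ y ⊕ x
⊕-swap a x y = trans (⊕-assoc a x y) (⊕-regroup a x y)

⊕-zeroʳ : ∀ {m} (a u : Vec ℕ m) → (∀ e → lookup u e ≡ 0) → a ⊕ u ≡ a
⊕-zeroʳ a u u≡0 = lookup-ext λ e →
  trans (lookup-⊕ a u e) (trans (cong (lookup a e ℕ.+_) (u≡0 e)) (ℕₚ.+-identityʳ _))

_≟ᴺ_ : ∀ {m} → DecidableEquality (Vec ℕ m)
_≟ᴺ_ = Vecₚ.≡-dec ℕₚ._≟_

_≟ᶻ_ : ∀ {n} → DecidableEquality (Vec ℤ n)
_≟ᶻ_ = Vecₚ.≡-dec ℤₚ._≟_

⌊⌋-⇔ : ∀ {a b} {A : Set a} {B : Set b} → A ⇔ B → (a? : Dec A) (b? : Dec B) → ⌊ a? ⌋ ≡ ⌊ b? ⌋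
⌊⌋-⇔ A⇔B a? b? = trans (isYes≗does a?) (trans (does-⇔ A⇔B a? b?) (sym (isYes≗does b?)))

module Coefficients {c ℓ} (R : CommutativeRing c ℓ) where
  open CommutativeRing R renaming (refl to ≈-refl; sym to ≈-sym; trans to ≈-trans)
  open SemiringSum semiring using (sum; sum-cong-≋; ∑-distrib-+; sum-replicate-zero)
  open SetoidReasoning setoid

  infixr 8 [_]·_
  [_]·_ : Bool → Carrier → Carrier
  [ b ]· x = if b then x else 0#

  []·-cong : ∀ b {x y} → x ≈ y → [ b ]· x ≈ [ b ]· y
  []·-cong true  x≈y = x≈y
  []·-cong false x≈y = ≈-refl

  []·-zero : ∀ b → [ b ]· 0# ≈ 0#
  []·-zero true  = ≈-refl
  []·-zero false = ≈-refl

  []·-+ : ∀ b x y → [ b ]· (x + y) ≈ [ b ]· x + [ b ]· y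
  []·-+ true  x y = ≈-refl
  []·-+ false x y = ≈-sym (+-identityˡ 0#)

  []·-comm : ∀ b b′ x → [ b ]· [ b′ ]· x ≡ [ b′ ]· [ b ]· x
  []·-comm true  true  x = ≡.refl
  []·-comm true  false x = ≡.refl
  []·-comm false true  x = ≡.refl
  []·-comm false false x = ≡.refl

  []·-cancel : ∀ β k → [ β ]· (- k) + [ β ]· k ≈ 0#
  []·-cancel true  k = -‿inverseˡ k
  []·-cancel false k = +-identityˡ 0#

  *-[]· : ∀ a b x → a * [ b ]· x ≈ [ b ]· (a * x)
  *-[]· a true  x = ≈-refl
  *-[]· a false x = zeroʳ a

  -- At the decidable equality of exponent vectors this is definitionally Polys.coeff (resp. Polys.lcoeff).
  coefficient : ∀ {E : Set} → DecidableEquality E → List (Carrier × E) → E → Carrier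
  coefficient _≟_ p u = foldr (λ t acc → if ⌊ proj₂ t ≟ u ⌋ then proj₁ t + acc else acc) 0# p

  relabel : ∀ {E E′ : Set} → (E → E′) → List (Carrier × E) → List (Carrier × E′)
  relabel ψ = List.map (λ t → (proj₁ t , ψ (proj₂ t)))

  module _ {E : Set} (_≟_ : DecidableEquality E) where

    coefficient-∷ : ∀ a e p u → coefficient _≟_ ((a , e) ∷ p) u ≈ [ ⌊ e ≟ u ⌋ ]· a + coefficient _≟_ p u
    coefficient-∷ a e p u with ⌊ e ≟ u ⌋
    ... | true  = ≈-refl
    ... | false = ≈-sym (+-identityˡ _)

    coefficient-++ : ∀ p q u → coefficient _≟_ (p ++ q) u ≈ coefficient _≟_ p u + coefficient _≟_ q u
    coefficient-++ []              q u = ≈-sym (+-identityˡ _)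
    coefficient-++ ((a , e) ∷ p) q u = begin
      coefficient _≟_ ((a , e) ∷ p ++ q) u                     ≈⟨ coefficient-∷ a e (p ++ q) u ⟩
      [ ⌊ e ≟ u ⌋ ]· a + coefficient _≟_ (p ++ q) u             ≈⟨ +-congˡ (coefficient-++ p q u) ⟩
      [ ⌊ e ≟ u ⌋ ]· a + (coefficient _≟_ p u + coefficient _≟_ q u) ≈⟨ +-assoc _ _ _ ⟨
      ([ ⌊ e ≟ u ⌋ ]· a + coefficient _≟_ p u) + coefficient _≟_ q u ≈⟨ +-congʳ (coefficient-∷ a e p u) ⟨
      coefficient _≟_ ((a , e) ∷ p) u + coefficient _≟_ q u ∎

    coefficient-pointwise : ∀ {p q} → Pointwise (λ s t → proj₁ s ≈ proj₁ t × proj₂ s ≡ proj₂ t) p q →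
                            ∀ u → coefficient _≟_ p u ≈ coefficient _≟_ q u
    coefficient-pointwise []                                     u = ≈-refl
    coefficient-pointwise {(a , e) ∷ p} {(b , _) ∷ q} ((a≈b , ≡.refl) ∷ p∼q) u = begin
      coefficient _≟_ ((a , e) ∷ p) u          ≈⟨ coefficient-∷ a e p u ⟩
      [ ⌊ e ≟ u ⌋ ]· a + coefficient _≟_ p u   ≈⟨ +-cong ([]·-cong ⌊ e ≟ u ⌋ a≈b) (coefficient-pointwise p∼q u) ⟩
      [ ⌊ e ≟ u ⌋ ]· b + coefficient _≟_ q u   ≈⟨ coefficient-∷ b e q u ⟨
      coefficient _≟_ ((b , e) ∷ q) u          ∎

    sum-indicator-unique : ∀ (D : List E) → Unique D → ∀ {e} → e ∈ D → (X : E → Carrier) →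
                           sum (λ i → [ ⌊ e ≟ List.lookup D i ⌋ ]· X (List.lookup D i)) ≈ X e
    sum-indicator-unique (d ∷ D) (d∉D ∷ _) (here ≡.refl) X with d ≟ d
    ... | no d≢d = ⊥-elim (d≢d ≡.refl)
    ... | yes _  =
      ≈-trans (+-congˡ (≈-trans (sum-cong-≋ rest-zero) (sum-replicate-zero (List.length D)))) (+-identityʳ (X d))
      where
      rest-zero : ∀ i → [ ⌊ d ≟ List.lookup D i ⌋ ]· X (List.lookup D i) ≈ 0#
      rest-zero i with d ≟ List.lookup D i
      ... | yes d≡ = ⊥-elim (All.lookup d∉D (∈-lookup i) d≡)
      ... | no _   = ≈-refl
    sum-indicator-unique (d ∷ D) (d∉D ∷ D!) {e} (there e∈D) X with e ≟ d
    ... | yes ≡.refl = ⊥-elim (All.lookup d∉D e∈D ≡.refl)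
    ... | no _       = ≈-trans (+-identityˡ _) (sum-indicator-unique D D! e∈D X)

    coefficient-relabel-∉ : ∀ {E₀ : Set} (ψ : E₀ → E) p v → (∀ t → t ∈ p → ψ (proj₂ t) ≢ v) →
                            coefficient _≟_ (relabel ψ p) v ≈ 0#
    coefficient-relabel-∉ ψ []            v ∉ = ≈-refl
    coefficient-relabel-∉ ψ ((a , e) ∷ p) v ∉ with ψ e ≟ v
    ... | yes ψe≡v = ⊥-elim (∉ (a , e) (here refl) ψe≡v)
    ... | no  _    = coefficient-relabel-∉ ψ p v (λ t t∈p → ∉ t (there t∈p))

    coefficient-relabel-⇔ : ∀ {E₁ E₂ : Set} (_≟₂_ : DecidableEquality E₂) (ψ : E₁ → E) (χ : E₁ → E₂) p v w →
                            (∀ e → (ψ e ≡ v) ⇔ (χ e ≡ w)) →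
                            coefficient _≟_ (relabel ψ p) v ≈ coefficient _≟₂_ (relabel χ p) w
    coefficient-relabel-⇔ _≟₂_ ψ χ []            v w same = ≈-refl
    coefficient-relabel-⇔ _≟₂_ ψ χ ((a , e) ∷ p) v w same
      rewrite ⌊⌋-⇔ (same e) (ψ e ≟ v) (χ e ≟₂ w) with ⌊ χ e ≟₂ w ⌋
    ... | true  = +-congˡ (coefficient-relabel-⇔ _≟₂_ ψ χ p v w same)
    ... | false = coefficient-relabel-⇔ _≟₂_ ψ χ p v w same

  module _ {E E′ : Set} (_≟_ : DecidableEquality E) (_≟′_ : DecidableEquality E′) (ψ : E → E′) where

    -- The right-hand side depends on p only through its coefficients.
    coefficient-relabel : ∀ (D : List E) → Unique D → (p : List (Carrier × E)) → All (λ t → proj₂ t ∈ D) p →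
      ∀ v → coefficient _≟′_ (relabel ψ p) v
              ≈ sum (λ i → [ ⌊ ψ (List.lookup D i) ≟′ v ⌋ ]· coefficient _≟_ p (List.lookup D i))
    coefficient-relabel D D! [] [] v =
      ≈-sym (≈-trans (sum-cong-≋ (λ i → []·-zero ⌊ ψ (List.lookup D i) ≟′ v ⌋))
                     (sum-replicate-zero (List.length D)))
    coefficient-relabel D D! ((a , e) ∷ p) (e∈D ∷ p⊆D) v = begin
      coefficient _≟′_ ((a , ψ e) ∷ relabel ψ p) v
        ≈⟨ coefficient-∷ _≟′_ a (ψ e) (relabel ψ p) v ⟩
      [ ⌊ ψ e ≟′ v ⌋ ]· a + coefficient _≟′_ (relabel ψ p) v
        ≈⟨ +-cong (sum-indicator-unique _≟_ D D! e∈D (λ u → [ ⌊ ψ u ≟′ v ⌋ ]· a))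
                  (≈-sym (coefficient-relabel D D! p p⊆D v)) ⟨
      sum (λ i → [ ⌊ e ≟ d i ⌋ ]· [ hit i ]· a) + sum (λ i → [ hit i ]· coefficient _≟_ p (d i))
        ≈⟨ ∑-distrib-+ (λ i → [ ⌊ e ≟ d i ⌋ ]· [ hit i ]· a) (λ i → [ hit i ]· coefficient _≟_ p (d i)) ⟨
      sum (λ i → [ ⌊ e ≟ d i ⌋ ]· [ hit i ]· a + [ hit i ]· coefficient _≟_ p (d i))
        ≈⟨ sum-cong-≋ regroup ⟩
      sum (λ i → [ hit i ]· coefficient _≟_ ((a , e) ∷ p) (d i)) ∎
      where
      d : Fin (List.length D) → E
      d = List.lookup D
      hit : Fin (List.length D) → Bool
      hit i = ⌊ ψ (d i) ≟′ v ⌋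
      regroup : ∀ i → [ ⌊ e ≟ d i ⌋ ]· [ hit i ]· a + [ hit i ]· coefficient _≟_ p (d i)
                    ≈ [ hit i ]· coefficient _≟_ ((a , e) ∷ p) (d i)
      regroup i = begin
        [ ⌊ e ≟ d i ⌋ ]· [ hit i ]· a + [ hit i ]· coefficient _≟_ p (d i)
          ≡⟨ cong (_+ [ hit i ]· coefficient _≟_ p (d i)) ([]·-comm ⌊ e ≟ d i ⌋ (hit i) a) ⟩
        [ hit i ]· [ ⌊ e ≟ d i ⌋ ]· a + [ hit i ]· coefficient _≟_ p (d i)
          ≈⟨ []·-+ (hit i) _ _ ⟨
        [ hit i ]· ([ ⌊ e ≟ d i ⌋ ]· a + coefficient _≟_ p (d i))
          ≈⟨ []·-cong (hit i) (coefficient-∷ _≟_ a e p (d i)) ⟨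
        [ hit i ]· coefficient _≟_ ((a , e) ∷ p) (d i) ∎

    coefficient-relabel-cong : ∀ p q → (∀ u → coefficient _≟_ p u ≈ coefficient _≟_ q u) →
                               ∀ v → coefficient _≟′_ (relabel ψ p) v ≈ coefficient _≟′_ (relabel ψ q) v
    coefficient-relabel-cong p q p≈q v = begin
      coefficient _≟′_ (relabel ψ p) v
        ≈⟨ coefficient-relabel D (deduplicate-! _≟_ exps) p (All.tabulate (covers ∘ ∈-++⁺ˡ)) v ⟩
      sum (λ i → [ ⌊ ψ (List.lookup D i) ≟′ v ⌋ ]· coefficient _≟_ p (List.lookup D i))
        ≈⟨ sum-cong-≋ (λ i → []·-cong ⌊ ψ (List.lookup D i) ≟′ v ⌋ (p≈q (List.lookup D i))) ⟩
      sum (λ i → [ ⌊ ψ (List.lookup D i) ≟′ v ⌋ ]· coefficient _≟_ q (List.lookup D i))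
        ≈⟨ coefficient-relabel D (deduplicate-! _≟_ exps) q (All.tabulate (covers ∘ ∈-++⁺ʳ p)) v ⟨
      coefficient _≟′_ (relabel ψ q) v ∎
      where
      exps D : List E
      exps = List.map proj₂ (p ++ q)
      D = List.deduplicate _≟_ exps
      covers : ∀ {t} → t ∈ p ++ q → proj₂ t ∈ D
      covers t∈ = ∈-deduplicate⁺ _≟_ (∈-map⁺ proj₂ t∈)

-- The grading φ on the signed covering

module Exponents {c ℓ} (K : Field c ℓ) {n m : ℕ} (G : SGraph n m) where
  open Toric K G
  open Covering G
  open import Data.Integer using (_+_; _-_; _*_; -_)

  lookup-φmono : ∀ u r → lookup (φmono u) r ≡ ∑ℤ.sum (λ e → + lookup u e * lookup (φexp e) r)
  lookup-φmono u r =
    trans (lookup-foldr-tabulate (λ e → Vec.map (λ z → + lookup u e * z) (φexp e)) (λ e → e) r)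
          (∑ℤ.sum-cong-≗ (λ e → Vecₚ.lookup-map r _ (φexp e)))

  lookup-φmono-⊕ : ∀ u v r → lookup (φmono (u ⊕ v)) r ≡ lookup (φmono u) r + lookup (φmono v) r
  lookup-φmono-⊕ u v r = begin
    lookup (φmono (u ⊕ v)) r
      ≡⟨ lookup-φmono (u ⊕ v) r ⟩
    ∑ℤ.sum (λ e → + lookup (u ⊕ v) e * x e)
      ≡⟨ ∑ℤ.sum-cong-≗ (λ e → trans (cong (λ k → + k * x e) (lookup-⊕ u v e))
                                    (trans (cong (_* x e) (ℤₚ.pos-+ (lookup u e) (lookup v e)))
                                           (ℤₚ.*-distribʳ-+ (x e) (+ lookup u e) (+ lookup v e)))) ⟩
    ∑ℤ.sum (λ e → + lookup u e * x e + + lookup v e * x e)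
      ≡⟨ ∑ℤ.∑-distrib-+ (λ e → + lookup u e * x e) (λ e → + lookup v e * x e) ⟩
    ∑ℤ.sum (λ e → + lookup u e * x e) + ∑ℤ.sum (λ e → + lookup v e * x e)
      ≡⟨ cong₂ _+_ (lookup-φmono u r) (lookup-φmono v r) ⟨
    lookup (φmono u) r + lookup (φmono v) r ∎
    where
    open ≡-Reasoning
    x : Fin m → ℤ
    x e = lookup (φexp e) r

  φmono-cancel : ∀ a b a′ b′ → φmono (a ⊕ b) ≡ φmono (a′ ⊕ b′) → φmono b ≡ φmono b′ → φmono a ≡ φmono a′
  φmono-cancel a b a′ b′ sum≡ b≡b′ = lookup-ext λ r →
    +-cancelʳ (lookup (φmono b) r) _ _ (begin
      lookup (φmono a) r + lookup (φmono b) r      ≡⟨ lookup-φmono-⊕ a b r ⟨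
      lookup (φmono (a ⊕ b)) r                     ≡⟨ cong (λ x → lookup x r) sum≡ ⟩
      lookup (φmono (a′ ⊕ b′)) r                   ≡⟨ lookup-φmono-⊕ a′ b′ r ⟩
      lookup (φmono a′) r + lookup (φmono b′) r    ≡⟨ cong (λ x → lookup (φmono a′) r + lookup x r) b≡b′ ⟨
      lookup (φmono a′) r + lookup (φmono b) r     ∎)
    where open ≡-Reasoning

  φmono-⊕-≡ : ∀ w e v → φmono (w ⊕ e) ≡ v ⇔ φmono e ≡ zipWith _-_ v (φmono w)
  φmono-⊕-≡ w e v = mk⇔
    (λ φ[w⊕e]≡v → lookup-ext λ r → begin
      lookup (φmono e) r                                           ≡⟨ cancel (lookup (φmono e) r) (lookup (φmono w) r) ⟩
      lookup (φmono w) r + lookup (φmono e) r - lookup (φmono w) r ≡⟨ cong (_- lookup (φmono w) r) (lookup-φmono-⊕ w e r) ⟨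
      lookup (φmono (w ⊕ e)) r - lookup (φmono w) r                ≡⟨ cong (λ z → lookup z r - lookup (φmono w) r) φ[w⊕e]≡v ⟩
      lookup v r - lookup (φmono w) r                              ≡⟨ Vecₚ.lookup-zipWith _-_ r v (φmono w) ⟨
      lookup (zipWith _-_ v (φmono w)) r                           ∎)
    (λ φe≡v-φw → lookup-ext λ r → begin
      lookup (φmono (w ⊕ e)) r                                     ≡⟨ lookup-φmono-⊕ w e r ⟩
      lookup (φmono w) r + lookup (φmono e) r
        ≡⟨ cong (_+_ (lookup (φmono w) r)) (trans (cong (λ z → lookup z r) φe≡v-φw) (Vecₚ.lookup-zipWith _-_ r v (φmono w))) ⟩
      lookup (φmono w) r + (lookup v r - lookup (φmono w) r)       ≡⟨ uncancel (lookup v r) (lookup (φmono w) r) ⟩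
      lookup v r                                                   ∎)
    where
    open ≡-Reasoning
    cancel : ∀ x y → x ≡ y + x - y
    cancel = solve-∀
    uncancel : ∀ x y → y + (x - y) ≡ x
    uncancel = solve-∀

  potential : CVert n → Fin n → ℤ
  potential nothing        r = 0ℤ
  potential (just (s , i)) r = lookup (unitℤ i s) r

  unitℤ-opposite : ∀ i s r → lookup (unitℤ i (opposite s)) r ≡ - lookup (unitℤ i s) r
  unitℤ-opposite i s r
    rewrite Vecₚ.lookup∘tabulate (λ k → if ⌊ k Fin.≟ i ⌋ then signℤ (opposite s) else + 0) r
          | Vecₚ.lookup∘tabulate (λ k → if ⌊ k Fin.≟ i ⌋ then signℤ s else + 0) r
    with ⌊ r Fin.≟ i ⌋ | s
  ... | true  | pos = refl
  ... | true  | neg = refl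
  ... | false | _   = refl

  φexp-potential : ∀ c r → lookup (φexp (π c)) r + potential (tgt c) r ≡ potential (src c) r
  φexp-potential (e , b) r with G e | b
  ... | link i δ j ε | true  rewrite Vecₚ.lookup-zipWith _+_ r (unitℤ i δ) (unitℤ j ε) | unitℤ-opposite j ε r =
    cancel (lookup (unitℤ i δ) r) (lookup (unitℤ j ε) r)
    where cancel : ∀ a b → (a + b) + - b ≡ a
          cancel = solve-∀
  ... | link i δ j ε | false rewrite Vecₚ.lookup-zipWith _+_ r (unitℤ i δ) (unitℤ j ε) | unitℤ-opposite i δ r =
    cancel (lookup (unitℤ i δ) r) (lookup (unitℤ j ε) r)
    where cancel : ∀ a b → (a + b) + - a ≡ b
          cancel = solve-∀
  ... | half i δ     | true  = ℤₚ.+-identityʳ _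
  ... | half i δ     | false rewrite unitℤ-opposite i δ r = ℤₚ.+-inverseʳ (lookup (unitℤ i δ) r)

  ∑-rotate : ∀ {l} (f : Fin (suc l) → ℤ) → ∑ℤ.sum (f ∘ next) ≡ ∑ℤ.sum f
  ∑-rotate {l} f = begin
    ∑ℤ.sum (f ∘ next)                              ≡⟨ ∑ℤ.sum-init-last (f ∘ next) ⟩
    ∑ℤ.sum (f ∘ next ∘ inject₁) + f (next (fromℕ l))
      ≡⟨ cong₂ _+_ (∑ℤ.sum-cong-≗ (cong f ∘ next-inject₁)) (cong f next-fromℕ) ⟩
    ∑ℤ.sum (f ∘ Fin.suc) + f Fin.zero               ≡⟨ ℤₚ.+-comm (∑ℤ.sum (f ∘ Fin.suc)) (f Fin.zero) ⟩
    ∑ℤ.sum f                                       ∎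
    where
    open ≡-Reasoning
    next-inject₁ : ∀ (j : Fin l) → next (inject₁ j) ≡ Fin.suc j
    next-inject₁ j with toℕ (inject₁ j) ℕ.<? l
    ... | yes p = Finₚ.toℕ-injective (trans (Finₚ.toℕ-fromℕ< (s≤s p)) (cong suc (Finₚ.toℕ-inject₁ j)))
    ... | no ¬p = ⊥-elim (¬p (subst (ℕ._< l) (sym (Finₚ.toℕ-inject₁ j)) (Finₚ.toℕ<n j)))
    next-fromℕ : next (fromℕ l) ≡ Fin.zero
    next-fromℕ with toℕ (fromℕ l) ℕ.<? l
    ... | yes p = ⊥-elim (ℕₚ.<-irrefl (Finₚ.toℕ-fromℕ l) p)
    ... | no _  = refl

  module _ (C : Cycle) where
    open Cycle C

    stepWeight : Bool → Fin (suc l) → Fin n → ℤ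
    stepWeight b k r = if ⌊ fwd k Bool.≟ b ⌋ then lookup (φexp (π (edge k))) r else 0ℤ

    lookup-φmono-expOf : ∀ b r → lookup (φmono (expOf C b)) r ≡ ∑ℤ.sum (λ k → stepWeight b k r)
    lookup-φmono-expOf b r = begin
      lookup (φmono (expOf C b)) r
        ≡⟨ lookup-φmono (expOf C b) r ⟩
      ∑ℤ.sum (λ e → + lookup (expOf C b) e * x e)
        ≡⟨ ∑ℤ.sum-cong-≗ (λ e → cong (λ k → + k * x e)
             (trans (Vecₚ.lookup∘tabulate _ e) (sum-map-allFin (λ k → occurs k e)))) ⟩
      ∑ℤ.sum (λ e → + ∑ℕ.sum (λ k → occurs k e) * x e)
        ≡⟨ ∑ℤ.sum-cong-≗ (λ e → trans (cong (_* x e) (+-∑ℕ (λ k → occurs k e)))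
                                      (∑ℤ.*-distribʳ-sum (x e) (λ k → + occurs k e))) ⟩
      ∑ℤ.sum (λ e → ∑ℤ.sum (λ k → + occurs k e * x e))
        ≡⟨ ∑ℤ.∑-comm (λ e k → + occurs k e * x e) ⟩
      ∑ℤ.sum (λ k → ∑ℤ.sum (λ e → + occurs k e * x e))
        ≡⟨ ∑ℤ.sum-cong-≗ step ⟩
      ∑ℤ.sum (λ k → stepWeight b k r) ∎
      where
      open ≡-Reasoning
      x : Fin m → ℤ
      x e = lookup (φexp e) r
      occurs : Fin (suc l) → Fin m → ℕ
      occurs k e = if ⌊ π (edge k) Fin.≟ e ⌋ ∧ ⌊ fwd k Bool.≟ b ⌋ then 1 else 0
      step : ∀ k → ∑ℤ.sum (λ e → + occurs k e * x e) ≡ stepWeight b k r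
      step k with ⌊ fwd k Bool.≟ b ⌋
      ... | true  = trans (∑ℤ.sum-cong-≗ indicator) (sum-indicator ℤₚ.+-*-semiring (π (edge k)) x)
        where indicator : ∀ e → + (if ⌊ π (edge k) Fin.≟ e ⌋ ∧ true then 1 else 0) * x e
                                ≡ (if ⌊ π (edge k) Fin.≟ e ⌋ then x e else 0ℤ)
              indicator e with ⌊ π (edge k) Fin.≟ e ⌋
              ... | true  = ℤₚ.*-identityˡ (x e)
              ... | false = refl
      ... | false = trans (∑ℤ.sum-cong-≗ zero-term) (∑ℤ.sum-replicate-zero m)
        where zero-term : ∀ e → + (if ⌊ π (edge k) Fin.≟ e ⌋ ∧ false then 1 else 0) * x e ≡ 0ℤ
              zero-term e with ⌊ π (edge k) Fin.≟ e ⌋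
              ... | true  = refl
              ... | false = refl

  -- The potential telescopes along the closed walk.
  cycle-balanced : ∀ C → φmono (expOf C true) ≡ φmono (expOf C false)
  cycle-balanced C = lookup-ext λ r →
    trans (lookup-φmono-expOf C true r)
   (trans (+-cancelʳ (∑ℤ.sum (Tfrom r)) _ _ (balance r))
          (sym (lookup-φmono-expOf C false r)))
    where
    open Cycle C
    Tfrom Tto : Fin n → Fin (suc l) → ℤ
    Tfrom r k = potential (stepFrom (edge k) (fwd k)) r
    Tto   r k = potential (stepTo (edge k) (fwd k)) r
    step-balance : ∀ r k → stepWeight C true k r + Tto r k ≡ stepWeight C false k r + Tfrom r k
    step-balance r k with fwd k
    ... | true  = trans (φexp-potential (edge k) r) (sym (ℤₚ.+-identityˡ _))
    ... | false = trans (ℤₚ.+-identityˡ _) (sym (φexp-potential (edge k) r))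
    balance : ∀ r → ∑ℤ.sum (λ k → stepWeight C true k r) + ∑ℤ.sum (Tfrom r)
                  ≡ ∑ℤ.sum (λ k → stepWeight C false k r) + ∑ℤ.sum (Tfrom r)
    balance r = begin
      ∑ℤ.sum (λ k → stepWeight C true k r) + ∑ℤ.sum (Tfrom r)
        ≡⟨ cong (_+_ (∑ℤ.sum (λ k → stepWeight C true k r)))
                (trans (sym (∑-rotate (Tfrom r)))
                       (∑ℤ.sum-cong-≗ (λ k → cong (λ v → potential v r) (sym (closed k))))) ⟩
      ∑ℤ.sum (λ k → stepWeight C true k r) + ∑ℤ.sum (Tto r)
        ≡⟨ ∑ℤ.∑-distrib-+ (λ k → stepWeight C true k r) (Tto r) ⟨
      ∑ℤ.sum (λ k → stepWeight C true k r + Tto r k)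
        ≡⟨ ∑ℤ.sum-cong-≗ (step-balance r) ⟩
      ∑ℤ.sum (λ k → stepWeight C false k r + Tfrom r k)
        ≡⟨ ∑ℤ.∑-distrib-+ (λ k → stepWeight C false k r) (Tfrom r) ⟩
      ∑ℤ.sum (λ k → stepWeight C false k r) + ∑ℤ.sum (Tfrom r) ∎
      where open ≡-Reasoning

-- Cycle binomials lie in the kernel

module Ideals {c ℓ} (K : Field c ℓ) {m : ℕ} {a} (Gen : Polys.Poly K m → Set a) where
  open Field K renaming (refl to ≈-refl; sym to ≈-sym; trans to ≈-trans)
  open Polys K
  open Coefficients commutativeRing
  open SetoidReasoning setoid

  Combination : Set _
  Combination = List (Poly m × Σ (Poly m) Gen)

  combination : Combination → Poly m
  combination = foldr (λ hg acc → (proj₁ hg *P proj₁ (proj₂ hg)) +P acc) 0P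

  InIdeal-≈ : ∀ {f g} → f ≈P g → InIdeal Gen g → InIdeal Gen f
  InIdeal-≈ f≈g (hs , g≈) = hs , λ u → ≈-trans (f≈g u) (g≈ u)

  combination-++ : ∀ hs hs′ u → coeff (combination (hs ++ hs′)) u ≈ coeff (combination hs) u + coeff (combination hs′) u
  combination-++ []              hs′ u = ≈-sym (+-identityˡ _)
  combination-++ ((h , g) ∷ hs) hs′ u = begin
    coeff ((h *P proj₁ g) ++ combination (hs ++ hs′)) u
      ≈⟨ coefficient-++ _≟ᴺ_ (h *P proj₁ g) (combination (hs ++ hs′)) u ⟩
    coeff (h *P proj₁ g) u + coeff (combination (hs ++ hs′)) u
      ≈⟨ +-congˡ (combination-++ hs hs′ u) ⟩
    coeff (h *P proj₁ g) u + (coeff (combination hs) u + coeff (combination hs′) u)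
      ≈⟨ +-assoc _ _ _ ⟨
    (coeff (h *P proj₁ g) u + coeff (combination hs) u) + coeff (combination hs′) u
      ≈⟨ +-congʳ (coefficient-++ _≟ᴺ_ (h *P proj₁ g) (combination hs) u) ⟨
    coeff (combination ((h , g) ∷ hs)) u + coeff (combination hs′) u ∎

  InIdeal-++ : ∀ {p q} → InIdeal Gen p → InIdeal Gen q → InIdeal Gen (p ++ q)
  InIdeal-++ {p} {q} (hs , p≈) (hs′ , q≈) = hs ++ hs′ , λ u → begin
    coeff (p ++ q) u                                    ≈⟨ coefficient-++ _≟ᴺ_ p q u ⟩
    coeff p u + coeff q u                               ≈⟨ +-cong (p≈ u) (q≈ u) ⟩
    coeff (combination hs) u + coeff (combination hs′) u ≈⟨ combination-++ hs hs′ u ⟨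
    coeff (combination (hs ++ hs′)) u                   ∎

module IdealInKernel {c ℓ} (K : Field c ℓ) {n m : ℕ} (G : SGraph n m) where
  open Field K renaming (refl to ≈-refl; sym to ≈-sym; trans to ≈-trans)
  open Polys K
  open Toric K G
  open Covering G
  open Exponents K G
  open Coefficients commutativeRing
  open Ideals K CycleBinomial
  open SetoidReasoning setoid

  φ-cong : ∀ p q → p ≈P q → φ p ≈L φ q
  φ-cong = coefficient-relabel-cong _≟ᴺ_ _≟ᶻ_ φmono

  φ-++ : ∀ (p q : Poly m) v → lcoeff (φ (p ++ q)) v ≈ lcoeff (φ p) v + lcoeff (φ q) v
  φ-++ p q v = ≈-trans (reflexive (cong (λ r → lcoeff r v) (Listₚ.map-++ _ p q))) (coefficient-++ _≟ᶻ_ (φ p) (φ q) v)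

  -- (a·x^w)·g, the summand of _*P_ contributed by the term (a , w)
  scale : Carrier → Vec ℕ m → Poly m → Poly m
  scale a w = List.map (λ t → (a * proj₁ t , w ⊕ proj₂ t))

  φ-shift : ∀ a w (g : Poly m) v →
    lcoeff (φ (scale a w g)) v ≈ a * lcoeff (φ g) (zipWith ℤ._-_ v (φmono w))
  φ-shift a w []            v = ≈-sym (zeroʳ a)
  φ-shift a w ((b , e) ∷ g) v = begin
    lcoeff ((a * b , φmono (w ⊕ e)) ∷ φ (scale a w g)) v
      ≈⟨ coefficient-∷ _≟ᶻ_ (a * b) (φmono (w ⊕ e)) (φ (scale a w g)) v ⟩
    [ ⌊ φmono (w ⊕ e) ≟ᶻ v ⌋ ]· (a * b) + lcoeff (φ (scale a w g)) v
      ≈⟨ +-cong (reflexive (cong (λ β → [ β ]· (a * b)) same-test)) (φ-shift a w g v) ⟩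
    [ ⌊ φmono e ≟ᶻ v′ ⌋ ]· (a * b) + a * lcoeff (φ g) v′
      ≈⟨ +-congʳ (*-[]· a ⌊ φmono e ≟ᶻ v′ ⌋ b) ⟨
    a * [ ⌊ φmono e ≟ᶻ v′ ⌋ ]· b + a * lcoeff (φ g) v′
      ≈⟨ distribˡ a _ _ ⟨
    a * ([ ⌊ φmono e ≟ᶻ v′ ⌋ ]· b + lcoeff (φ g) v′)
      ≈⟨ *-congˡ (coefficient-∷ _≟ᶻ_ b (φmono e) (φ g) v′) ⟨
    a * lcoeff (φ ((b , e) ∷ g)) v′ ∎
    where
    v′ : Vec ℤ n
    v′ = zipWith ℤ._-_ v (φmono w)
    same-test : ⌊ φmono (w ⊕ e) ≟ᶻ v ⌋ ≡ ⌊ φmono e ≟ᶻ v′ ⌋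
    same-test = ⌊⌋-⇔ (φmono-⊕-≡ w e v) (φmono (w ⊕ e) ≟ᶻ v) (φmono e ≟ᶻ v′)

  *P-kernel : ∀ (h g : Poly m) → InToricIdeal g → InToricIdeal (h *P g)
  *P-kernel []            g g∈ker v = ≈-refl
  *P-kernel ((a , w) ∷ h) g g∈ker v = begin
    lcoeff (φ (scale a w g ++ (h *P g))) v
      ≈⟨ φ-++ (scale a w g) (h *P g) v ⟩
    lcoeff (φ (scale a w g)) v + lcoeff (φ (h *P g)) v
      ≈⟨ +-cong (≈-trans (φ-shift a w g v) (≈-trans (*-congˡ (g∈ker (zipWith ℤ._-_ v (φmono w)))) (zeroʳ a)))
                (*P-kernel h g g∈ker v) ⟩
    0# + 0#
      ≈⟨ +-identityˡ 0# ⟩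
    0# ∎

  U-kernel : ∀ C → InToricIdeal (U C)
  U-kernel C v rewrite cycle-balanced C with φmono (expOf C false) ≟ᶻ v
  ... | yes _ = ≈-trans (+-congˡ (+-identityʳ (- 1#))) (-‿inverseʳ 1#)
  ... | no  _ = ≈-refl

  combination-kernel : ∀ hs → InToricIdeal (combination hs)
  combination-kernel []                            v = ≈-refl
  combination-kernel ((h , g , C , _ , g≈U) ∷ hs) v = begin
    lcoeff (φ ((h *P g) ++ combination hs)) v
      ≈⟨ φ-++ (h *P g) (combination hs) v ⟩
    lcoeff (φ (h *P g)) v + lcoeff (φ (combination hs)) v
      ≈⟨ +-cong (*P-kernel h g (λ w → ≈-trans (φ-cong g (U C) g≈U w) (U-kernel C w)) v) (combination-kernel hs v) ⟩
    0# + 0#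
      ≈⟨ +-identityˡ 0# ⟩
    0# ∎

  ideal⊆kernel : ∀ f → InIdeal CycleBinomial f → InToricIdeal f
  ideal⊆kernel f (hs , f≈) v = ≈-trans (φ-cong f (combination hs) f≈ v) (combination-kernel hs v)

-- Walks in the signed covering

snoc : ∀ {A : Set} → (ℕ → A) → ℕ → A → ℕ → A
snoc f L x i = if ⌊ i ℕ.≟ L ⌋ then x else f i

snoc-last : ∀ {A : Set} (f : ℕ → A) L x → snoc f L x L ≡ x
snoc-last f L x with L ℕ.≟ L
... | yes _  = refl
... | no L≢L = ⊥-elim (L≢L refl)

snoc-init : ∀ {A : Set} (f : ℕ → A) L x i → i < L → snoc f L x i ≡ f i
snoc-init f L x i i<L with i ℕ.≟ L
... | yes refl = ⊥-elim (ℕₚ.<-irrefl refl i<L)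
... | no  _    = refl

module Lifts {c ℓ} (K : Field c ℓ) {n m : ℕ} (G : SGraph n m) where
  open Toric K G
  open Covering G
  open Exponents K G
  open import Data.Integer using (_+_; _-_; _*_)

  lookup-unitℤ : ∀ a δ i → lookup (unitℤ a δ) i ≡ (if ⌊ i Fin.≟ a ⌋ then signℤ δ else 0ℤ)
  lookup-unitℤ a δ = Vecₚ.lookup∘tabulate (λ k → if ⌊ k Fin.≟ a ⌋ then signℤ δ else 0ℤ)

  unitℤ-positive : ∀ a δ i s → 0ℤ ℤ.< signℤ s * lookup (unitℤ a δ) i → i ≡ a × δ ≡ s
  unitℤ-positive a δ i s s·u>0 rewrite lookup-unitℤ a δ i with i Fin.≟ a | δ | s | s·u>0
  ... | yes i≡a | pos | pos | _          = i≡a , refl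
  ... | yes i≡a | neg | neg | _          = i≡a , refl
  ... | yes _   | pos | neg | ()
  ... | yes _   | neg | pos | ()
  ... | no  _   | _   | pos | ℤ.+<+ ()
  ... | no  _   | _   | neg | ℤ.+<+ ()

  unitℤ-negative : ∀ a δ i s → signℤ s * lookup (unitℤ a δ) i ℤ.< 0ℤ → i ≡ a × δ ≡ opposite s
  unitℤ-negative a δ i s s·u<0 rewrite lookup-unitℤ a δ i with i Fin.≟ a | δ | s | s·u<0
  ... | yes i≡a | pos | neg | _          = i≡a , refl
  ... | yes i≡a | neg | pos | _          = i≡a , refl
  ... | yes _   | pos | pos | ℤ.+<+ ()
  ... | yes _   | neg | neg | ℤ.+<+ ()
  ... | no  _   | _   | pos | ℤ.+<+ ()
  ... | no  _   | _   | neg | ℤ.+<+ ()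

  not-eqLoop : ∀ {a b : Fin n} {δ ε} → ¬ (a ≡ b × δ ≡ ε) → not (isEqLoop (link a δ b ε)) ≡ true
  not-eqLoop {a} {b} {δ} {ε} ¬loop with a Fin.≟ b | δ Signₚ.≟ ε
  ... | yes a≡b | yes δ≡ε = ⊥-elim (¬loop (a≡b , δ≡ε))
  ... | yes _   | no  _   = refl
  ... | no  _   | _       = refl

  lift-from : ∀ e i s → 0ℤ ℤ.< signℤ s * lookup (φexp e) i →
              ∃ λ b → present (e , b) ≡ true × src (e , b) ≡ just (s , i)
  lift-from e i s s·x>0 with G e in Ge
  ... | half a δ with unitℤ-positive a δ i s s·x>0
  ...   | refl , refl = true , refl , refl
  lift-from e i s s·x>0 | link a δ b ε
    rewrite Vecₚ.lookup-zipWith _+_ i (unitℤ a δ) (unitℤ b ε)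
          | ℤₚ.*-distribˡ-+ (signℤ s) (lookup (unitℤ a δ) i) (lookup (unitℤ b ε) i)
    with 0ℤ ℤ.<? signℤ s * lookup (unitℤ a δ) i
  ... | yes a>0 with unitℤ-positive a δ i s a>0
  ...   | refl , refl = true , refl , refl
  lift-from e i s s·x>0 | link a δ b ε | no a≯0
    with unitℤ-positive b ε i s (positive-summand _ _ s·x>0 a≯0)
  ...   | refl , refl = false , present-false , refl
    where
    present-false : not (isEqLoop (G e)) ≡ true
    present-false = trans (cong (not ∘ isEqLoop) Ge)
      (not-eqLoop {a} {i} {δ} {s} (λ { (refl , refl) → a≯0 (positive-summand _ _ s·x>0 a≯0) }))

  lift-to : ∀ e i s → signℤ s * lookup (φexp e) i ℤ.< 0ℤ →
            ∃ λ b → present (e , b) ≡ true × tgt (e , b) ≡ just (s , i)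
  lift-to e i s s·x<0 with G e in Ge
  ... | half a δ with unitℤ-negative a δ i s s·x<0
  ...   | refl , refl = false , cong (not ∘ isEqLoop) Ge , cong (λ t → just (t , i)) (Signₚ.opposite-involutive s)
  lift-to e i s s·x<0 | link a δ b ε
    rewrite Vecₚ.lookup-zipWith _+_ i (unitℤ a δ) (unitℤ b ε)
          | ℤₚ.*-distribˡ-+ (signℤ s) (lookup (unitℤ a δ) i) (lookup (unitℤ b ε) i)
          | ℤₚ.+-comm (signℤ s * lookup (unitℤ a δ) i) (signℤ s * lookup (unitℤ b ε) i)
    with signℤ s * lookup (unitℤ b ε) i ℤ.<? 0ℤ
  ... | yes b<0 with unitℤ-negative b ε i s b<0
  ...   | refl , refl = true , refl , cong (λ t → just (t , i)) (Signₚ.opposite-involutive s)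
  lift-to e i s s·x<0 | link a δ b ε | no b≮0
    with unitℤ-negative a δ i s (negative-summand _ _ s·x<0 b≮0)
  ...   | refl , refl = false , present-false , cong (λ t → just (t , i)) (Signₚ.opposite-involutive s)
    where
    present-false : not (isEqLoop (G e)) ≡ true
    present-false = trans (cong (not ∘ isEqLoop) Ge)
      (not-eqLoop {i} {b} {opposite s} {ε} (λ { (refl , refl) → b≮0 (negative-summand _ _ s·x<0 b≮0) }))

  potential-gap : ∀ s i w → w ≢ just (s , i) → 0ℤ ℤ.< signℤ s * (potential (just (s , i)) i - potential w i)
  potential-gap s i nothing _ rewrite lookup-unitℤ i s i with i Fin.≟ i | s
  ... | yes _ | pos = ℤ.+<+ (s≤s z≤n)
  ... | yes _ | neg = ℤ.+<+ (s≤s z≤n)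
  ... | no i≢i | _  = ⊥-elim (i≢i refl)
  potential-gap s i (just (s′ , i′)) w≢ rewrite lookup-unitℤ i s i | lookup-unitℤ i′ s′ i
    with i Fin.≟ i | i Fin.≟ i′ | s | s′
  ... | no i≢i | _        | _   | _   = ⊥-elim (i≢i refl)
  ... | yes _  | yes refl | pos | pos = ⊥-elim (w≢ refl)
  ... | yes _  | yes refl | neg | neg = ⊥-elim (w≢ refl)
  ... | yes _  | yes refl | pos | neg = ℤ.+<+ (s≤s z≤n)
  ... | yes _  | yes refl | neg | pos = ℤ.+<+ (s≤s z≤n)
  ... | yes _  | no  _    | pos | _   = ℤ.+<+ (s≤s z≤n)
  ... | yes _  | no  _    | neg | _   = ℤ.+<+ (s≤s z≤n)

module Walks {c ℓ} (K : Field c ℓ) {n m : ℕ} (G : SGraph n m) (u v : Vec ℕ m)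
             (φu≡φv : Toric.φmono K G u ≡ Toric.φmono K G v)
             (disjoint : ∀ e → lookup u e ≡ 0 ⊎ lookup v e ≡ 0) where
  open Toric K G
  open Covering G
  open Exponents K G
  open Lifts K G
  open import Data.Integer using (_+_; _-_; _*_; -_)

  Step : Set
  Step = CEdge m × Bool

  from to : Step → CVert n
  from s = stepFrom (proj₁ s) (proj₂ s)
  to   s = stepTo   (proj₁ s) (proj₂ s)

  -- forward steps are paid for by u, backward steps by v
  original : Bool → Vec ℕ m
  original b = if b then u else v

  Usable : (Bool → Vec ℕ m) → Step → Set
  Usable w s = 0 < lookup (w (proj₂ s)) (π (proj₁ s))

  occurs : Step → Bool → Fin m → ℕ
  occurs s b e = if ⌊ π (proj₁ s) Fin.≟ e ⌋ ∧ ⌊ proj₂ s Bool.≟ b ⌋ then 1 else 0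

  spend : (Bool → Vec ℕ m) → Step → Bool → Vec ℕ m
  spend w s b = if ⌊ proj₂ s Bool.≟ b ⌋ then w b ⊖ unit (π (proj₁ s)) else w b

  occurs+spend : ∀ w s → Usable w s → ∀ b e → occurs s b e ℕ.+ lookup (spend w s b) e ≡ lookup (w b) e
  occurs+spend w (c , f) usable b e with f Bool.≟ b
  ... | yes refl = begin
    (if ⌊ π c Fin.≟ e ⌋ ∧ true then 1 else 0) ℕ.+ lookup (w f ⊖ unit (π c)) e
      ≡⟨ cong (λ d → (if d then 1 else 0) ℕ.+ lookup (w f ⊖ unit (π c)) e) (Boolₚ.∧-identityʳ _) ⟩
    (if ⌊ π c Fin.≟ e ⌋ then 1 else 0) ℕ.+ lookup (w f ⊖ unit (π c)) e
      ≡⟨ cong (ℕ._+ lookup (w f ⊖ unit (π c)) e) (Vecₚ.lookup∘tabulate (λ e′ → if ⌊ π c Fin.≟ e′ ⌋ then 1 else 0) e) ⟨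
    lookup (unit (π c)) e ℕ.+ lookup (w f ⊖ unit (π c)) e
      ≡⟨ ℕₚ.+-comm (lookup (unit (π c)) e) _ ⟩
    lookup (w f ⊖ unit (π c)) e ℕ.+ lookup (unit (π c)) e
      ≡⟨ lookup-⊕ (w f ⊖ unit (π c)) (unit (π c)) e ⟨
    lookup (w f ⊖ unit (π c) ⊕ unit (π c)) e
      ≡⟨ cong (λ x → lookup x e) (⊖-⊕ (w f) (unit (π c)) (unit≤ (w f) (π c) usable)) ⟩
    lookup (w f) e ∎
    where open ≡-Reasoning
  ... | no _ = cong (λ d → (if d then 1 else 0) ℕ.+ lookup (w b) e) (Boolₚ.∧-zeroʳ _)

  lookup-φmono-unit : ∀ e r → lookup (φmono (unit e)) r ≡ lookup (φexp e) r
  lookup-φmono-unit e r =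
    trans (lookup-φmono (unit e) r)
          (trans (∑ℤ.sum-cong-≗ indicator) (sum-indicator ℤₚ.+-*-semiring e (λ e′ → lookup (φexp e′) r)))
    where
    indicator : ∀ e′ → + lookup (unit e) e′ * lookup (φexp e′) r ≡ (if ⌊ e Fin.≟ e′ ⌋ then lookup (φexp e′) r else 0ℤ)
    indicator e′ rewrite Vecₚ.lookup∘tabulate (λ e′ → if ⌊ e Fin.≟ e′ ⌋ then 1 else 0) e′ with ⌊ e Fin.≟ e′ ⌋
    ... | true  = ℤₚ.*-identityˡ _
    ... | false = refl

  φmono-⊖-unit : ∀ a e → 0 < lookup a e → ∀ r → lookup (φmono a) r ≡ lookup (φmono (a ⊖ unit e)) r + lookup (φexp e) r
  φmono-⊖-unit a e a>0 r = begin
    lookup (φmono a) r                                         ≡⟨ cong (λ x → lookup (φmono x) r) (⊖-⊕ a (unit e) (unit≤ a e a>0)) ⟨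
    lookup (φmono (a ⊖ unit e ⊕ unit e)) r                     ≡⟨ lookup-φmono-⊕ (a ⊖ unit e) (unit e) r ⟩
    lookup (φmono (a ⊖ unit e)) r + lookup (φmono (unit e)) r  ≡⟨ cong (_+_ (lookup (φmono (a ⊖ unit e)) r)) (lookup-φmono-unit e r) ⟩
    lookup (φmono (a ⊖ unit e)) r + lookup (φexp e) r          ∎
    where open ≡-Reasoning

  signed-gap : ∀ (a b : Vec ℕ m) σ i →
    signℤ σ * (lookup (φmono a) i - lookup (φmono b) i)
      ≡ ∑ℤ.sum (λ e → + lookup a e * (signℤ σ * lookup (φexp e) i) + + lookup b e * - (signℤ σ * lookup (φexp e) i))
  signed-gap a b σ i = begin
    s * (lookup (φmono a) i - lookup (φmono b) i)
      ≡⟨ cong₂ (λ A B → s * (A - B)) (lookup-φmono a i) (lookup-φmono b i) ⟩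
    s * (∑ℤ.sum A - ∑ℤ.sum B)
      ≡⟨ distrib s (∑ℤ.sum A) (∑ℤ.sum B) ⟩
    s * ∑ℤ.sum A + - (s * ∑ℤ.sum B)
      ≡⟨ cong₂ (λ X Y → X + - Y) (∑ℤ.*-distribˡ-sum s A) (∑ℤ.*-distribˡ-sum s B) ⟩
    ∑ℤ.sum (λ e → s * A e) + - ∑ℤ.sum (λ e → s * B e)
      ≡⟨ cong (_+_ (∑ℤ.sum (λ e → s * A e))) (∑ℤ-neg (λ e → s * B e)) ⟨
    ∑ℤ.sum (λ e → s * A e) + ∑ℤ.sum (λ e → - (s * B e))
      ≡⟨ ∑ℤ.∑-distrib-+ (λ e → s * A e) (λ e → - (s * B e)) ⟨
    ∑ℤ.sum (λ e → s * A e + - (s * B e))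
      ≡⟨ ∑ℤ.sum-cong-≗ (λ e → regroup s (+ lookup a e) (+ lookup b e) (lookup (φexp e) i)) ⟩
    ∑ℤ.sum (λ e → + lookup a e * (s * lookup (φexp e) i) + + lookup b e * - (s * lookup (φexp e) i)) ∎
    where
    open ≡-Reasoning
    s : ℤ
    s = signℤ σ
    A B : Fin m → ℤ
    A e = + lookup a e * lookup (φexp e) i
    B e = + lookup b e * lookup (φexp e) i
    distrib : ∀ s A B → s * (A - B) ≡ s * A + - (s * B)
    distrib = solve-∀
    regroup : ∀ s a b x → s * (a * x) + - (s * (b * x)) ≡ a * (s * x) + b * - (s * x)
    regroup = solve-∀

  _≟ᵛ_ : DecidableEquality (CVert n)
  _≟ᵛ_ = Maybeₚ.≡-dec (Productₚ.≡-dec Signₚ._≟_ Finₚ._≟_)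

  IsHalf : SEdge n → Set
  IsHalf (link _ _ _ _) = ⊥
  IsHalf (half _ _)     = ⊤

  to-nothing : ∀ s → to s ≡ nothing → IsHalf (G (π (proj₁ s)))
  to-nothing ((e , b) , f) to≡nothing with G e | b | f
  ... | half _ _     | _     | _     = tt
  ... | link _ _ _ _ | true  | true  = case to≡nothing of λ ()
  ... | link _ _ _ _ | true  | false = case to≡nothing of λ ()
  ... | link _ _ _ _ | false | true  = case to≡nothing of λ ()
  ... | link _ _ _ _ | false | false = case to≡nothing of λ ()

  ι-π : ∀ c → π (ι c) ≡ π c
  ι-π (e , b) with isEqLoop (G e)
  ... | true  = refl
  ... | false = refl

  ι-involutive : ∀ c → ι (ι c) ≡ c
  ι-involutive (e , b) with isEqLoop (G e) in loop
  ... | true  rewrite loop = refl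
  ... | false rewrite loop = cong (e ,_) (Boolₚ.not-involutive b)

  same-direction : ∀ s s′ → Usable original s → Usable original s′ → π (proj₁ s) ≡ π (proj₁ s′) → proj₂ s ≡ proj₂ s′
  same-direction (c , true)  (c′ , true)  _   _    _ = refl
  same-direction (c , false) (c′ , false) _   _    _ = refl
  same-direction (c , true)  (c′ , false) u>0 v>0 π≡ with disjoint (π c)
  ... | inj₁ u≡0 = ⊥-elim (ℕₚ.<-irrefl (sym u≡0) u>0)
  ... | inj₂ v≡0 = ⊥-elim (ℕₚ.<-irrefl (sym (trans (cong (lookup v) (sym π≡)) v≡0)) v>0)
  same-direction (c , false) (c′ , true)  v>0 u>0 π≡ with disjoint (π c)
  ... | inj₁ u≡0 = ⊥-elim (ℕₚ.<-irrefl (sym (trans (cong (lookup u) (sym π≡)) u≡0)) u>0)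
  ... | inj₂ v≡0 = ⊥-elim (ℕₚ.<-irrefl (sym v≡0) v>0)

  not-fixed : (C : Cycle) → (∀ k → Usable original (Cycle.edge C k , Cycle.fwd C k)) → ¬ FixedOrientationwise C
  not-fixed C usable (_ , W⇔ιA) with Cycle.fwd C Fin.zero in fwd₀
  ... | true  with Equivalence.to (W⇔ιA (edge Fin.zero)) (Fin.zero , refl , fwd₀)
    where open Cycle C
  ...   | k , edge≡ , fwd-k = case trans (sym fwd₀) (trans fwd₀≡fwd-k fwd-k) of λ ()
    where
    open Cycle C
    fwd₀≡fwd-k : fwd Fin.zero ≡ fwd k
    fwd₀≡fwd-k = same-direction (edge Fin.zero , fwd Fin.zero) (edge k , fwd k) (usable Fin.zero) (usable k)
                                (sym (trans (cong π edge≡) (ι-π (edge Fin.zero))))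
  not-fixed C usable (_ , W⇔ιA) | false
    with Equivalence.from (W⇔ιA (ι (edge Fin.zero))) (Fin.zero , sym (ι-involutive (edge Fin.zero)) , fwd₀)
    where open Cycle C
  ...   | k , edge≡ , fwd-k = case trans (sym fwd-k) (trans fwd-k≡fwd₀ fwd₀) of λ ()
    where
    open Cycle C
    fwd-k≡fwd₀ : fwd k ≡ fwd Fin.zero
    fwd-k≡fwd₀ = same-direction (edge k , fwd k) (edge Fin.zero , fwd Fin.zero) (usable k) (usable Fin.zero)
                                (trans (cong π edge≡) (ι-π (edge Fin.zero)))

  next-cases : ∀ {l} (k : Fin (suc l)) → toℕ (next k) ≡ suc (toℕ k) ⊎ (toℕ k ≡ l × next k ≡ Fin.zero)
  next-cases {l} k with toℕ k ℕ.<? l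
  ... | yes k<l = inj₁ (Finₚ.toℕ-fromℕ< (s≤s k<l))
  ... | no  k≮l = inj₂ (ℕₚ.≤-antisym (ℕₚ.≤-pred (Finₚ.toℕ<n k)) (ℕₚ.≮⇒≥ k≮l) , refl)

  CycleWithin : Set
  CycleWithin = Σ Cycle λ C → ¬ FixedOrientationwise C × (∀ b e → lookup (expOf C b) e ≤ lookup (original b) e)

  module FromStart (start : CVert n)
                   (halfFree : start ≢ nothing → ∀ e → IsHalf (G e) → lookup u e ≡ 0 × lookup v e ≡ 0) where

    vertexOf : (ℕ → Step) → ℕ → CVert n
    vertexOf step zero    = start
    vertexOf step (suc i) = to (step i)

    count : (ℕ → Step) → ℕ → Bool → Fin m → ℕ
    count step L b e = ∑ℕ.sum {L} (λ i → occurs (step (toℕ i)) b e)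

    vertexOf-snoc : ∀ step L s i → i ≤ L → vertexOf (snoc step L s) i ≡ vertexOf step i
    vertexOf-snoc step L s zero    _   = refl
    vertexOf-snoc step L s (suc i) i<L = cong to (snoc-init step L s i i<L)

    record Walk : Set where
      field
        len          : ℕ
        step         : ℕ → Step
        budget       : Bool → Vec ℕ m
        step-from    : ∀ i → i < len → from (step i) ≡ vertexOf step i
        step-present : ∀ i → i < len → present (proj₁ (step i)) ≡ true
        step-usable  : ∀ i → i < len → Usable original (step i)
        spent        : ∀ b e → count step len b e ℕ.+ lookup (budget b) e ≡ lookup (original b) e
        balanced     : ∀ r → lookup (φmono (budget true)) r - lookup (φmono (budget false)) r
                               ≡ potential (vertexOf step len) r - potential start r

      end : CVert n
      end = vertexOf step len

      vertex : ℕ → CVert n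
      vertex = vertexOf step

      total : ℕ
      total = degree (budget true) ℕ.+ degree (budget false)

      budget≤original : ∀ b e → lookup (budget b) e ≤ lookup (original b) e
      budget≤original b e = subst (lookup (budget b) e ≤_) (spent b e) (ℕₚ.m≤n+m _ _)

    open Walk

    empty : Step → Walk
    empty s₀ = record
      { len = 0 ; step = λ _ → s₀ ; budget = original
      ; step-from = λ _ () ; step-present = λ _ () ; step-usable = λ _ ()
      ; spent = λ _ _ → refl
      ; balanced = λ r → trans (cong (λ x → lookup (φmono u) r - lookup x r) (sym φu≡φv))
                               (trans (ℤₚ.+-inverseʳ (lookup (φmono u) r)) (sym (ℤₚ.+-inverseʳ (potential start r))))
      }

    extend : (W : Walk) (s : Step) → from s ≡ end W → present (proj₁ s) ≡ true → Usable (budget W) s → Walk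
    extend W s s-from s-present s-usable = record
      { len = suc (len W) ; step = step′ ; budget = spend (budget W) s
      ; step-from = step-from′ ; step-present = step-present′ ; step-usable = step-usable′
      ; spent = spent′ ; balanced = balanced′ }
      where
      L : ℕ
      L = len W
      step′ : ℕ → Step
      step′ = snoc (step W) L s
      step′-init : ∀ i → i < L → step′ i ≡ step W i
      step′-init = snoc-init (step W) L s
      vertex′-init : ∀ i → i ≤ L → vertexOf step′ i ≡ vertex W i
      vertex′-init = vertexOf-snoc (step W) L s
      step-from′ : ∀ i → i < suc L → from (step′ i) ≡ vertexOf step′ i
      step-from′ i i<1+L with ℕₚ.m<1+n⇒m<n∨m≡n i<1+L
      ... | inj₁ i<L  = trans (cong from (step′-init i i<L)) (trans (step-from W i i<L) (sym (vertex′-init i (ℕₚ.<⇒≤ i<L))))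
      ... | inj₂ refl = trans (cong from (snoc-last (step W) L s)) (trans s-from (sym (vertex′-init L ℕₚ.≤-refl)))
      step-present′ : ∀ i → i < suc L → present (proj₁ (step′ i)) ≡ true
      step-present′ i i<1+L with ℕₚ.m<1+n⇒m<n∨m≡n i<1+L
      ... | inj₁ i<L  = trans (cong (present ∘ proj₁) (step′-init i i<L)) (step-present W i i<L)
      ... | inj₂ refl = trans (cong (present ∘ proj₁) (snoc-last (step W) L s)) s-present
      step-usable′ : ∀ i → i < suc L → Usable original (step′ i)
      step-usable′ i i<1+L with ℕₚ.m<1+n⇒m<n∨m≡n i<1+L
      ... | inj₁ i<L  = subst (Usable original) (sym (step′-init i i<L)) (step-usable W i i<L)
      ... | inj₂ refl = subst (Usable original) (sym (snoc-last (step W) L s))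
                              (ℕₚ.<-≤-trans s-usable (budget≤original W (proj₂ s) (π (proj₁ s))))
      spent′ : ∀ b e → count step′ (suc L) b e ℕ.+ lookup (spend (budget W) s b) e ≡ lookup (original b) e
      spent′ b e = begin
        count step′ (suc L) b e ℕ.+ lookup (spend (budget W) s b) e
          ≡⟨ cong (ℕ._+ lookup (spend (budget W) s b) e) (∑ℕ-snoc L (λ i → occurs (step′ i) b e)) ⟩
        count step′ L b e ℕ.+ occurs (step′ L) b e ℕ.+ lookup (spend (budget W) s b) e
          ≡⟨ cong₂ (λ x y → x ℕ.+ occurs y b e ℕ.+ lookup (spend (budget W) s b) e)
                   (∑ℕ-cong-< L (λ i i<L → cong (λ y → occurs y b e) (step′-init i i<L))) (snoc-last (step W) L s) ⟩
        count (step W) L b e ℕ.+ occurs s b e ℕ.+ lookup (spend (budget W) s b) e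
          ≡⟨ ℕₚ.+-assoc (count (step W) L b e) _ _ ⟩
        count (step W) L b e ℕ.+ (occurs s b e ℕ.+ lookup (spend (budget W) s b) e)
          ≡⟨ cong (count (step W) L b e ℕ.+_) (occurs+spend (budget W) s s-usable b e) ⟩
        count (step W) L b e ℕ.+ lookup (budget W b) e
          ≡⟨ spent W b e ⟩
        lookup (original b) e ∎
        where open ≡-Reasoning
      balanced′ : ∀ r → lookup (φmono (spend (budget W) s true)) r - lookup (φmono (spend (budget W) s false)) r
                          ≡ potential (vertexOf step′ (suc L)) r - potential start r
      balanced′ r rewrite snoc-last (step W) L s = shift s s-from s-usable
        where
        shift : ∀ s → from s ≡ end W → Usable (budget W) s →
                lookup (φmono (spend (budget W) s true)) r - lookup (φmono (spend (budget W) s false)) r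
                  ≡ potential (to s) r - potential start r
        shift (c , true) s-from s-usable = begin
          a′ - b                              ≡⟨ insert a′ b x ⟩
          a′ + x - b - x                      ≡⟨ cong (λ z → z - b - x) (φmono-⊖-unit (budget W true) (π c) s-usable r) ⟨
          a - b - x                           ≡⟨ cong (_- x) (balanced W r) ⟩
          potential (end W) r - t₀ - x        ≡⟨ cong (λ z → z - t₀ - x) (trans (φexp-potential c r) (cong (λ z → potential z r) s-from)) ⟨
          x + potential (tgt c) r - t₀ - x    ≡⟨ remove x (potential (tgt c) r) t₀ ⟩
          potential (tgt c) r - t₀            ∎
          where
          open ≡-Reasoning
          a a′ b x t₀ : ℤ
          a = lookup (φmono (budget W true)) r
          a′ = lookup (φmono (budget W true ⊖ unit (π c))) r
          b = lookup (φmono (budget W false)) r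
          x = lookup (φexp (π c)) r
          t₀ = potential start r
          insert : ∀ a b x → a - b ≡ a + x - b - x
          insert = solve-∀
          remove : ∀ x t s → x + t - s - x ≡ t - s
          remove = solve-∀
        shift (c , false) s-from s-usable = begin
          a - b′                              ≡⟨ insert a b′ x ⟩
          a - (b′ + x) + x                    ≡⟨ cong (λ z → a - z + x) (φmono-⊖-unit (budget W false) (π c) s-usable r) ⟨
          a - b + x                           ≡⟨ cong (_+ x) (balanced W r) ⟩
          potential (end W) r - t₀ + x        ≡⟨ reorder (potential (end W) r) t₀ x ⟩
          x + potential (end W) r - t₀        ≡⟨ cong (λ z → x + potential z r - t₀) s-from ⟨
          x + potential (tgt c) r - t₀        ≡⟨ cong (_- t₀) (φexp-potential c r) ⟩
          potential (src c) r - t₀            ∎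
          where
          open ≡-Reasoning
          a b b′ x t₀ : ℤ
          a = lookup (φmono (budget W true)) r
          b = lookup (φmono (budget W false)) r
          b′ = lookup (φmono (budget W false ⊖ unit (π c))) r
          x = lookup (φexp (π c)) r
          t₀ = potential start r
          insert : ∀ a b x → a - b ≡ a - (b + x) + x
          insert = solve-∀
          reorder : ∀ t s x → t - s + x ≡ x + t - s
          reorder = solve-∀

    extend-end : ∀ W s s-from s-present s-usable → end (extend W s s-from s-present s-usable) ≡ to s
    extend-end W s _ _ _ = cong to (snoc-last (step W) (len W) s)

    total-extend : ∀ W s s-from s-present s-usable → suc (total (extend W s s-from s-present s-usable)) ≡ total W
    total-extend W (c , true)  _ _ s-usable =
      cong (ℕ._+ degree (budget W false)) (sym (degree-⊖-unit (budget W true) (π c) s-usable))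
    total-extend W (c , false) _ _ s-usable =
      trans (sym (ℕₚ.+-suc (degree (budget W true)) _))
            (cong (degree (budget W true) ℕ.+_) (sym (degree-⊖-unit (budget W false) (π c) s-usable)))

    total-positive : ∀ W s → Usable (budget W) s → 0 < total W
    total-positive W (c , true)  s-usable = ℕₚ.≤-trans (degree-positive (budget W true) (π c) s-usable) (ℕₚ.m≤m+n _ _)
    total-positive W (c , false) s-usable = ℕₚ.≤-trans (degree-positive (budget W false) (π c) s-usable) (ℕₚ.m≤n+m _ _)

    original-zero : ∀ e → lookup u e ≡ 0 → lookup v e ≡ 0 → ∀ b → lookup (original b) e ≡ 0
    original-zero e u≡0 v≡0 true  = u≡0
    original-zero e u≡0 v≡0 false = v≡0

    -- The potential gap between the end and the start of the walk forces an unused edge at the end.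
    available : ∀ W → 1 ≤ len W → end W ≢ start →
                Σ Step λ s → from s ≡ end W × present (proj₁ s) ≡ true × Usable (budget W) s
    available W 1≤len end≢start with end W in end≡
    ... | nothing = ⊥-elim (ℕₚ.<-irrefl (sym (original-zero e u≡0 v≡0 (proj₂ last))) (step-usable W L L<len))
      where
      L : ℕ
      L = len W ℕ.∸ 1
      1+L≡len : suc L ≡ len W
      1+L≡len = ℕₚ.m+[n∸m]≡n 1≤len
      L<len : L < len W
      L<len = subst (L <_) 1+L≡len (ℕₚ.n<1+n L)
      last : Step
      last = step W L
      e : Fin m
      e = π (proj₁ last)
      last-to-nothing : to last ≡ nothing
      last-to-nothing = trans (cong (vertex W) 1+L≡len) end≡
      start≢nothing : start ≢ nothing
      start≢nothing start≡ = end≢start (sym start≡)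
      u≡0 : lookup u e ≡ 0
      u≡0 = proj₁ (halfFree start≢nothing e (to-nothing last last-to-nothing))
      v≡0 : lookup v e ≡ 0
      v≡0 = proj₂ (halfFree start≢nothing e (to-nothing last last-to-nothing))
    ... | just (σ , i) with positive-term-∑ℤ _ (subst (0ℤ ℤ.<_) (signed-gap (budget W true) (budget W false) σ i) gap)
      where
      gap : 0ℤ ℤ.< signℤ σ * (lookup (φmono (budget W true)) i - lookup (φmono (budget W false)) i)
      gap = subst (λ z → 0ℤ ℤ.< signℤ σ * z)
                  (sym (trans (balanced W i) (cong (λ w → potential w i - potential start i) end≡)))
                  (potential-gap σ i start (λ start≡ → end≢start (sym start≡)))
    ... | e , term>0 with 0ℤ ℤ.<? + lookup (budget W true) e * (signℤ σ * lookup (φexp e) i)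
    ...   | yes forward>0 with +*-positive _ _ forward>0
    ...     | bt>0 , y>0 with lift-from e i σ y>0
    ...       | b , b-present , src≡ = ((e , b) , true) , src≡ , b-present , bt>0
    available W 1≤len end≢start | just (σ , i) | e , term>0 | no forward≯0
      with +*-positive _ _ (positive-summand _ _ term>0 forward≯0)
    ...     | bf>0 , -y>0 with lift-to e i σ (ℤₚ.neg-cancel-< -y>0)
    ...       | b , b-present , tgt≡ = ((e , b) , false) , tgt≡ , b-present , bf>0

    Distinct : Walk → ℕ → Set
    Distinct W q = ∀ i j → i ≤ q → j ≤ q → vertex W i ≡ vertex W j → i ≡ j

    extract : ∀ W p q → p ≤ q → q < len W → vertex W (suc q) ≡ vertex W p → Distinct W q → CycleWithin
    extract W p q p≤q q<len closes distinct = C , not-fixed C (λ k → step-usable W (idx k) (idx<len k)) , within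
      where
      l : ℕ
      l = q ℕ.∸ p
      p+l≡q : p ℕ.+ l ≡ q
      p+l≡q = ℕₚ.m+[n∸m]≡n p≤q
      idx : Fin (suc l) → ℕ
      idx k = p ℕ.+ toℕ k
      idx≤q : ∀ k → idx k ≤ q
      idx≤q k = subst (idx k ≤_) p+l≡q (ℕₚ.+-monoʳ-≤ p (ℕₚ.≤-pred (Finₚ.toℕ<n k)))
      idx<len : ∀ k → idx k < len W
      idx<len k = ℕₚ.≤-<-trans (idx≤q k) q<len
      from-idx : ∀ k → from (step W (idx k)) ≡ vertex W (idx k)
      from-idx k = step-from W (idx k) (idx<len k)
      closed : ∀ k → to (step W (idx k)) ≡ from (step W (idx (next k)))
      closed k with next-cases k
      ... | inj₁ next≡ =
        trans (cong (vertex W) (trans (sym (ℕₚ.+-suc p (toℕ k))) (cong (p ℕ.+_) (sym next≡)))) (sym (from-idx (next k)))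
      ... | inj₂ (k≡l , next≡0) =
        trans (cong (λ j → vertex W (suc (p ℕ.+ j))) k≡l)
       (trans (cong (vertex W ∘ suc) p+l≡q)
       (trans closes
       (trans (cong (vertex W) (trans (sym (ℕₚ.+-identityʳ p)) (cong (λ j → p ℕ.+ toℕ j) (sym next≡0))))
              (sym (from-idx (next k))))))
      vertices-distinct : ∀ k k′ → from (step W (idx k)) ≡ from (step W (idx k′)) → k ≡ k′
      vertices-distinct k k′ from≡ =
        Finₚ.toℕ-injective (ℕₚ.+-cancelˡ-≡ p _ _ (distinct (idx k) (idx k′) (idx≤q k) (idx≤q k′)
          (trans (sym (from-idx k)) (trans from≡ (from-idx k′)))))
      edges-distinct : ∀ k k′ → proj₁ (step W (idx k)) ≡ proj₁ (step W (idx k′)) → k ≡ k′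
      edges-distinct k k′ edge≡ = vertices-distinct k k′ (cong₂ stepFrom edge≡
        (same-direction (step W (idx k)) (step W (idx k′)) (step-usable W (idx k) (idx<len k))
                        (step-usable W (idx k′) (idx<len k′)) (cong π edge≡)))
      C : Cycle
      C = record
        { l = l ; edge = λ k → proj₁ (step W (idx k)) ; fwd = λ k → proj₂ (step W (idx k))
        ; edges-present = λ k → step-present W (idx k) (idx<len k)
        ; closed = closed ; vertices-distinct = vertices-distinct ; edges-distinct = edges-distinct }
      within : ∀ b e → lookup (expOf C b) e ≤ lookup (original b) e
      within b e = begin
        lookup (expOf C b) e
          ≡⟨ trans (Vecₚ.lookup∘tabulate (λ e → sumᴸ (List.map (λ k → occurs (step W (idx k)) b e) (allFin (suc l))))
                                         e)
                   (sum-map-allFin (λ k → occurs (step W (idx k)) b e)) ⟩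
        ∑ℕ.sum {suc l} (λ k → occurs (step W (p ℕ.+ toℕ k)) b e)
          ≤⟨ ∑ℕ-segment p (suc l) (len W) (λ i → occurs (step W i) b e)
                        (subst (_≤ len W) (trans (cong suc (sym p+l≡q)) (sym (ℕₚ.+-suc p l))) q<len) ⟩
        count (step W) (len W) b e
          ≤⟨ ℕₚ.m≤m+n _ _ ⟩
        count (step W) (len W) b e ℕ.+ lookup (budget W b) e
          ≡⟨ spent W b e ⟩
        lookup (original b) e ∎
        where open ℕₚ.≤-Reasoning

    close-or-continue : ∀ W s s-from s-present s-usable → Distinct W (len W) →
                        CycleWithin ⊎ Distinct (extend W s s-from s-present s-usable) (suc (len W))
    close-or-continue W s s-from s-present s-usable distinct
      with Finₚ.any? (λ (p : Fin (suc (len W))) → vertex W (toℕ p) ≟ᵛ to s)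
    ... | yes (p , p-closes) = inj₁ (extract W′ (toℕ p) L (ℕₚ.≤-pred (Finₚ.toℕ<n p)) (ℕₚ.n<1+n L) closes distinct′)
      where
      L : ℕ
      L = len W
      W′ : Walk
      W′ = extend W s s-from s-present s-usable
      closes : vertex W′ (suc L) ≡ vertex W′ (toℕ p)
      closes = trans (extend-end W s s-from s-present s-usable)
                     (sym (trans (vertexOf-snoc (step W) L s (toℕ p) (ℕₚ.≤-pred (Finₚ.toℕ<n p))) p-closes))
      distinct′ : Distinct W′ L
      distinct′ i j i≤L j≤L vᵢ≡vⱼ = distinct i j i≤L j≤L
        (trans (sym (vertexOf-snoc (step W) L s i i≤L)) (trans vᵢ≡vⱼ (vertexOf-snoc (step W) L s j j≤L)))
    ... | no ¬closes = inj₂ distinct′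
      where
      L : ℕ
      L = len W
      W′ : Walk
      W′ = extend W s s-from s-present s-usable
      old : ∀ i → i < suc L → vertex W′ i ≡ vertex W i
      old i i<1+L = vertexOf-snoc (step W) L s i (ℕₚ.≤-pred i<1+L)
      new≢old : ∀ i → i < suc L → vertex W′ (suc L) ≢ vertex W′ i
      new≢old i i<1+L new≡ = ¬closes (Fin.fromℕ< i<1+L ,
        trans (cong (vertex W) (Finₚ.toℕ-fromℕ< i<1+L))
              (trans (sym (old i i<1+L)) (trans (sym new≡) (extend-end W s s-from s-present s-usable))))
      distinct′ : Distinct W′ (suc L)
      distinct′ i j i≤ j≤ vᵢ≡vⱼ with ℕₚ.m≤n⇒m<n∨m≡n i≤ | ℕₚ.m≤n⇒m<n∨m≡n j≤
      ... | inj₁ i<  | inj₁ j<  = distinct i j (ℕₚ.≤-pred i<) (ℕₚ.≤-pred j<) (trans (sym (old i i<)) (trans vᵢ≡vⱼ (old j j<)))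
      ... | inj₂ refl | inj₂ refl = refl
      ... | inj₂ refl | inj₁ j<  = ⊥-elim (new≢old j j< vᵢ≡vⱼ)
      ... | inj₁ i<  | inj₂ refl = ⊥-elim (new≢old i i< (sym vᵢ≡vⱼ))

    end≢start : ∀ W → 1 ≤ len W → Distinct W (len W) → end W ≢ start
    end≢start W 1≤len distinct end≡ = ℕₚ.<-irrefl (sym (distinct (len W) 0 ℕₚ.≤-refl z≤n end≡)) 1≤len

    -- Each step uses up one unit of u or v, so the walk must close up eventually.
    grow : ∀ fuel W → total W ≤ fuel → 1 ≤ len W → Distinct W (len W) → CycleWithin
    grow zero W total≤0 1≤len distinct with available W 1≤len (end≢start W 1≤len distinct)
    ... | s , _ , _ , s-usable = ⊥-elim (ℕₚ.n≮0 (ℕₚ.<-≤-trans (total-positive W s s-usable) total≤0))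
    grow (suc fuel) W total≤1+fuel 1≤len distinct with available W 1≤len (end≢start W 1≤len distinct)
    ... | s , s-from , s-present , s-usable with close-or-continue W s s-from s-present s-usable distinct
    ...   | inj₁ cycle     = cycle
    ...   | inj₂ distinct′ =
      grow fuel (extend W s s-from s-present s-usable)
           (ℕₚ.≤-pred (subst (_≤ suc fuel) (sym (total-extend W s s-from s-present s-usable)) total≤1+fuel))
           (s≤s z≤n) distinct′

    first-step : ∀ s₀ → from s₀ ≡ start → present (proj₁ s₀) ≡ true → Usable original s₀ → CycleWithin
    first-step s₀ s₀-from s₀-present s₀-usable
      with close-or-continue (empty s₀) s₀ s₀-from s₀-present s₀-usable (λ { zero zero _ _ _ → refl })
    ... | inj₁ cycle    = cycle
    ... | inj₂ distinct = grow (total W₁) W₁ ℕₚ.≤-refl (s≤s z≤n) distinct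
      where
      W₁ : Walk
      W₁ = extend (empty s₀) s₀ s₀-from s₀-present s₀-usable

  isHalf? : ∀ x → Dec (IsHalf x)
  isHalf? (link _ _ _ _) = no λ ()
  isHalf? (half _ _)     = yes tt

  half-present : ∀ e → IsHalf (G e) → present (e , false) ≡ true
  half-present e half-e with G e
  ... | half _ _ = refl

  half-src : ∀ e → IsHalf (G e) → src (e , false) ≡ nothing
  half-src e half-e with G e
  ... | half _ _ = refl

  half-tgt : ∀ e → IsHalf (G e) → tgt (e , true) ≡ nothing
  half-tgt e half-e with G e
  ... | half _ _ = refl

  half-unused : ¬ (∃ λ e → IsHalf (G e) × (0 < lookup u e ⊎ 0 < lookup v e)) →
                ∀ e → IsHalf (G e) → lookup u e ≡ 0 × lookup v e ≡ 0
  half-unused ¬half-used e half-e = ℕₚ.n≤0⇒n≡0 (ℕₚ.≮⇒≥ (λ u>0 → ¬half-used (e , half-e , inj₁ u>0))) ,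
                                    ℕₚ.n≤0⇒n≡0 (ℕₚ.≮⇒≥ (λ v>0 → ¬half-used (e , half-e , inj₂ v>0)))

  -- Start at 0 along a half-edge if u or v uses one; otherwise the walk can never reach 0.
  find-cycle : ∀ e₀ → 0 < lookup u e₀ ⊎ 0 < lookup v e₀ → CycleWithin
  find-cycle e₀ e₀-used
    with Finₚ.any? (λ e → isHalf? (G e) ×-dec (0 ℕ.<? lookup u e ⊎-dec 0 ℕ.<? lookup v e))
  ... | yes (e , half-e , inj₁ u>0) = FromStart.first-step nothing (λ 0≢0 → ⊥-elim (0≢0 refl))
                                        ((e , false) , true) (half-src e half-e) (half-present e half-e) u>0
  ... | yes (e , half-e , inj₂ v>0) = FromStart.first-step nothing (λ 0≢0 → ⊥-elim (0≢0 refl))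
                                        ((e , true) , false) (half-tgt e half-e) refl v>0
  ... | no ¬half-used with e₀-used
  ...   | inj₁ u>0 = FromStart.first-step (src (e₀ , true)) (λ _ → half-unused ¬half-used)
                                          ((e₀ , true) , true) refl refl u>0
  ...   | inj₂ v>0 = FromStart.first-step (tgt (e₀ , true)) (λ _ → half-unused ¬half-used)
                                          ((e₀ , true) , false) refl refl v>0

-- The kernel is generated by the cycle binomials

module BinomialReduction {c ℓ} (K : Field c ℓ) {n m : ℕ} (G : SGraph n m) where
  open Field K renaming (refl to ≈-refl; sym to ≈-sym; trans to ≈-trans)
  open Polys K
  open Toric K G
  open Covering G
  open Exponents K G
  open Coefficients commutativeRing
  open Ideals K CycleBinomial

  binomialₖ : Carrier → Vec ℕ m → Vec ℕ m → Poly m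
  binomialₖ k a b = (k , a) ∷ (- k , b) ∷ []

  binomialₖ-self : ∀ k a → binomialₖ k a a ≈P 0P
  binomialₖ-self k a w = begin
    coeff (binomialₖ k a a) w                         ≈⟨ coefficient-∷ _≟ᴺ_ k a ((- k , a) ∷ []) w ⟩
    [ ⌊ a ≟ᴺ w ⌋ ]· k + coeff ((- k , a) ∷ []) w       ≈⟨ +-congˡ (coefficient-∷ _≟ᴺ_ (- k) a [] w) ⟩
    [ ⌊ a ≟ᴺ w ⌋ ]· k + ([ ⌊ a ≟ᴺ w ⌋ ]· (- k) + 0#)    ≈⟨ +-congˡ (+-identityʳ _) ⟩
    [ ⌊ a ≟ᴺ w ⌋ ]· k + [ ⌊ a ≟ᴺ w ⌋ ]· (- k)           ≈⟨ +-comm _ _ ⟩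
    [ ⌊ a ≟ᴺ w ⌋ ]· (- k) + [ ⌊ a ≟ᴺ w ⌋ ]· k           ≈⟨ []·-cancel ⌊ a ≟ᴺ w ⌋ k ⟩
    0#                                               ∎
    where open SetoidReasoning setoid

  binomialₖ-chain : ∀ k a b c w → coeff (binomialₖ k a b) w + coeff (binomialₖ k b c) w ≈ coeff (binomialₖ k a c) w
  binomialₖ-chain k a b c w = begin
    coeff (binomialₖ k a b) w + coeff (binomialₖ k b c) w
      ≈⟨ +-cong (≈-trans (coefficient-∷ _≟ᴺ_ k a ((- k , b) ∷ []) w)
                         (+-congˡ (≈-trans (coefficient-∷ _≟ᴺ_ (- k) b [] w) (+-identityʳ _))))
                (coefficient-∷ _≟ᴺ_ k b ((- k , c) ∷ []) w) ⟩
    (A + [ β ]· (- k)) + ([ β ]· k + C)    ≈⟨ +-assoc A _ _ ⟩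
    A + ([ β ]· (- k) + ([ β ]· k + C))    ≈⟨ +-congˡ (+-assoc _ _ C) ⟨
    A + (([ β ]· (- k) + [ β ]· k) + C)    ≈⟨ +-congˡ (+-congʳ ([]·-cancel β k)) ⟩
    A + (0# + C)                           ≈⟨ +-congˡ (+-identityˡ C) ⟩
    A + C                                  ≈⟨ coefficient-∷ _≟ᴺ_ k a ((- k , c) ∷ []) w ⟨
    coeff (binomialₖ k a c) w              ∎
    where
    open SetoidReasoning setoid
    A : Carrier
    A = [ ⌊ a ≟ᴺ w ⌋ ]· k
    β : Bool
    β = ⌊ b ≟ᴺ w ⌋
    C : Carrier
    C = coeff ((- k , c) ∷ []) w

  binomialₖ-trivial : ∀ k a u v → (∀ e → lookup u e ≡ 0) → (∀ e → lookup v e ≡ 0) →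
                      InIdeal CycleBinomial (binomialₖ k (a ⊕ u) (a ⊕ v))
  binomialₖ-trivial k a u v u≡0 v≡0 =
    [] , subst₂ (λ x y → binomialₖ k x y ≈P 0P) (sym (⊕-zeroʳ a u u≡0)) (sym (⊕-zeroʳ a v v≡0)) (binomialₖ-self k a)

  cycle-counts-first-edge : ∀ C → 0 < lookup (expOf C (Cycle.fwd C Fin.zero)) (π (Cycle.edge C Fin.zero))
  cycle-counts-first-edge C = begin
    1                                     ≡⟨ counted ⟨
    occurrences Fin.zero                  ≤⟨ term≤∑ℕ occurrences Fin.zero ⟩
    ∑ℕ.sum occurrences                    ≡⟨ sum-map-allFin occurrences ⟨
    sumᴸ (List.map occurrences (allFin (suc l))) ≡⟨ Vecₚ.lookup∘tabulate _ (π (edge Fin.zero)) ⟨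
    lookup (expOf C (fwd Fin.zero)) (π (edge Fin.zero)) ∎
    where
    open Cycle C
    open ℕₚ.≤-Reasoning
    occurrences : Fin (suc l) → ℕ
    occurrences k = if ⌊ π (edge k) Fin.≟ π (edge Fin.zero) ⌋ ∧ ⌊ fwd k Bool.≟ fwd Fin.zero ⌋ then 1 else 0
    counted : occurrences Fin.zero ≡ 1
    counted with π (edge Fin.zero) Fin.≟ π (edge Fin.zero) | fwd Fin.zero Bool.≟ fwd Fin.zero
    ... | yes _   | yes _   = refl
    ... | no  π≢π | _       = ⊥-elim (π≢π refl)
    ... | yes _   | no  f≢f = ⊥-elim (f≢f refl)

  cycle-degree-positive : ∀ C → 1 ≤ degree (expOf C true) ℕ.+ degree (expOf C false)
  cycle-degree-positive C =
    into-sum (Cycle.fwd C Fin.zero) (degree-positive (expOf C (Cycle.fwd C Fin.zero)) _ (cycle-counts-first-edge C))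
    where
    into-sum : ∀ b → 0 < degree (expOf C b) → 1 ≤ degree (expOf C true) ℕ.+ degree (expOf C false)
    into-sum true  deg>0 = ℕₚ.≤-trans deg>0 (ℕₚ.m≤m+n _ _)
    into-sum false deg>0 = ℕₚ.≤-trans deg>0 (ℕₚ.m≤n+m _ _)

  entry-zero : ∀ (u : Vec ℕ m) → degree u ≤ 0 → ∀ e → lookup u e ≡ 0
  entry-zero u deg≤0 e = ℕₚ.n≤0⇒n≡0 (ℕₚ.≤-trans (term≤∑ℕ (lookup u) e) deg≤0)

  binomial∈ideal : ∀ N k a u v → degree u ℕ.+ degree v ≤ N → φmono u ≡ φmono v →
                   InIdeal CycleBinomial (binomialₖ k (a ⊕ u) (a ⊕ v))
  binomial∈ideal zero k a u v deg≤0 _ =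
    binomialₖ-trivial k a u v (entry-zero u (ℕₚ.≤-trans (ℕₚ.m≤m+n _ _) deg≤0))
                              (entry-zero v (ℕₚ.≤-trans (ℕₚ.m≤n+m _ _) deg≤0))
  binomial∈ideal (suc N) k a u v deg≤1+N φu≡φv
    with Finₚ.any? (λ e → 0 ℕ.<? lookup u e ×-dec 0 ℕ.<? lookup v e)
  ... | yes (e , u>0 , v>0) =
    subst (InIdeal CycleBinomial) (cong₂ (binomialₖ k) (shift u u>0) (shift v v>0))
          (binomial∈ideal N k (a ⊕ unit e) (u ⊖ unit e) (v ⊖ unit e) deg′ φ′)
    where
    restore : ∀ x → 0 < lookup x e → x ⊖ unit e ⊕ unit e ≡ x
    restore x x>0 = ⊖-⊕ x (unit e) (unit≤ x e x>0)
    shift : ∀ x → 0 < lookup x e → a ⊕ unit e ⊕ (x ⊖ unit e) ≡ a ⊕ x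
    shift x x>0 = trans (sym (⊕-regroup a (x ⊖ unit e) (unit e))) (cong (a ⊕_) (restore x x>0))
    φ′ : φmono (u ⊖ unit e) ≡ φmono (v ⊖ unit e)
    φ′ = φmono-cancel (u ⊖ unit e) (unit e) (v ⊖ unit e) (unit e)
           (trans (cong φmono (restore u u>0)) (trans φu≡φv (sym (cong φmono (restore v v>0))))) refl
    deg′ : degree (u ⊖ unit e) ℕ.+ degree (v ⊖ unit e) ≤ N
    deg′ = ℕₚ.≤-trans (ℕₚ.+-monoʳ-≤ (degree (u ⊖ unit e)) (ℕₚ.n≤1+n _))
             (ℕₚ.≤-pred (subst (_≤ suc N) (cong₂ ℕ._+_ (degree-⊖-unit u e u>0) (degree-⊖-unit v e v>0)) deg≤1+N))
  ... | no ¬shared with Finₚ.any? (λ e → 0 ℕ.<? lookup u e ⊎-dec 0 ℕ.<? lookup v e)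
  ...   | no ¬used = binomialₖ-trivial k a u v
      (λ e → ℕₚ.n≤0⇒n≡0 (ℕₚ.≮⇒≥ (λ u>0 → ¬used (e , inj₁ u>0))))
      (λ e → ℕₚ.n≤0⇒n≡0 (ℕₚ.≮⇒≥ (λ v>0 → ¬used (e , inj₂ v>0))))
  ...   | yes (e₀ , e₀-used) with Walks.find-cycle K G u v φu≡φv disjoint e₀ e₀-used
    where
    disjoint : ∀ e → lookup u e ≡ 0 ⊎ lookup v e ≡ 0
    disjoint e with 0 ℕ.<? lookup u e
    ... | yes u>0 = inj₂ (ℕₚ.n≤0⇒n≡0 (ℕₚ.≮⇒≥ (λ v>0 → ¬shared (e , u>0 , v>0))))
    ... | no  u≯0 = inj₁ (ℕₚ.n≤0⇒n≡0 (ℕₚ.≮⇒≥ u≯0))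
  ...     | C , C-not-fixed , C-within = term ∷ proj₁ rest , λ x → begin
    coeff (binomialₖ k (a ⊕ u) (a ⊕ v)) x
      ≈⟨ binomialₖ-chain k (a ⊕ u) M (a ⊕ v) x ⟨
    coeff (binomialₖ k (a ⊕ u) M) x + coeff (binomialₖ k M (a ⊕ v)) x
      ≈⟨ +-cong (coefficient-pointwise _≟ᴺ_ cycle-part x)
                (≈-trans (reflexive (cong (λ y → coeff (binomialₖ k M y) x) a⊕v≡)) (proj₂ rest x)) ⟩
    coeff (((k , a ⊕ u′) ∷ []) *P U C) x + coeff (combination (proj₁ rest)) x
      ≈⟨ coefficient-++ _≟ᴺ_ (((k , a ⊕ u′) ∷ []) *P U C) (combination (proj₁ rest)) x ⟨
    coeff (combination (term ∷ proj₁ rest)) x ∎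
    where
    open SetoidReasoning setoid
    open RingProperties ring using (-‿distribʳ-*)
    w w′ u′ v′ M : Vec ℕ m
    w = expOf C true
    w′ = expOf C false
    u′ = u ⊖ w
    v′ = v ⊖ w′
    M = a ⊕ w′ ⊕ u′
    u′⊕w≡u : u′ ⊕ w ≡ u
    u′⊕w≡u = ⊖-⊕ u w (C-within true)
    v′⊕w′≡v : v′ ⊕ w′ ≡ v
    v′⊕w′≡v = ⊖-⊕ v w′ (C-within false)
    a⊕v≡ : a ⊕ v ≡ a ⊕ w′ ⊕ v′
    a⊕v≡ = trans (cong (a ⊕_) (sym v′⊕w′≡v)) (⊕-regroup a v′ w′)
    φ′ : φmono u′ ≡ φmono v′
    φ′ = φmono-cancel u′ w v′ w′ (trans (cong φmono u′⊕w≡u) (trans φu≡φv (sym (cong φmono v′⊕w′≡v)))) (cycle-balanced C)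
    deg′ : degree u′ ℕ.+ degree v′ ≤ N
    deg′ = ℕₚ.≤-pred (ℕₚ.≤-trans (subst (_≤ (degree u′ ℕ.+ degree v′) ℕ.+ (degree w ℕ.+ degree w′))
                                        (ℕₚ.+-comm (degree u′ ℕ.+ degree v′) 1)
                                        (ℕₚ.+-monoʳ-≤ (degree u′ ℕ.+ degree v′) (cycle-degree-positive C)))
                                 (subst (_≤ suc N) degrees deg≤1+N))
      where
      open CommutativeSemigroupProperties ℕₚ.+-commutativeSemigroup using (interchange)
      degrees : degree u ℕ.+ degree v ≡ (degree u′ ℕ.+ degree v′) ℕ.+ (degree w ℕ.+ degree w′)
      degrees = trans (cong₂ ℕ._+_ (trans (cong degree (sym u′⊕w≡u)) (degree-⊕ u′ w))
                                   (trans (cong degree (sym v′⊕w′≡v)) (degree-⊕ v′ w′)))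
                      (interchange (degree u′) (degree w) (degree v′) (degree w′))
    rest : InIdeal CycleBinomial (binomialₖ k (a ⊕ w′ ⊕ u′) (a ⊕ w′ ⊕ v′))
    rest = binomial∈ideal N k (a ⊕ w′) u′ v′ deg′ φ′
    term : Poly m × Σ (Poly m) CycleBinomial
    term = ((k , a ⊕ u′) ∷ []) , U C , C , C-not-fixed , (λ _ → ≈-refl)
    cycle-part : Pointwise (λ s t → proj₁ s ≈ proj₁ t × proj₂ s ≡ proj₂ t)
                           (binomialₖ k (a ⊕ u) M) (((k , a ⊕ u′) ∷ []) *P U C)
    cycle-part = (≈-sym (*-identityʳ k) , trans (cong (a ⊕_) (sym u′⊕w≡u)) (sym (⊕-assoc a u′ w)))
               ∷ (≈-trans (-‿cong (≈-sym (*-identityʳ k))) (-‿distribʳ-* k 1#) , ⊕-swap a w′ u′)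
               ∷ []

module _ {a p} {A : Set a} {P : A → Set p} (P? : ∀ x → Dec (P x)) where

  find-sound : ∀ xs {x} → List.find P? xs ≡ just x → P x
  find-sound (y ∷ xs) found with P? y
  find-sound (y ∷ xs) refl | yes Py = Py
  ... | no  _  = find-sound xs found

  find-complete : ∀ xs {y} → y ∈ xs → P y → List.find P? xs ≢ nothing
  find-complete (x ∷ xs) y∈ Py with P? x
  ... | yes _ = λ ()
  find-complete (x ∷ xs) (here refl)  Py | no ¬Px = ⊥-elim (¬Px Py)
  find-complete (x ∷ xs) (there y∈xs) Py | no _   = find-complete xs y∈xs Py

module KernelInIdeal {c ℓ} (K : Field c ℓ) {n m : ℕ} (G : SGraph n m) where
  open Field K renaming (refl to ≈-refl; sym to ≈-sym; trans to ≈-trans)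
  open Polys K
  open Toric K G
  open Exponents K G
  open Coefficients commutativeRing
  open Ideals K CycleBinomial
  open BinomialReduction K G

  -- F = Σ aₜ(x^eₜ - x^r(eₜ)) + Σ aₜ x^r(eₜ) for a choice r of representatives of the φ-fibres; in the
  -- second sum the coefficient of a representative x is that of t^φ(x) in φ(F), so it vanishes on ker φ.
  module Representatives (F : Poly m) where

    search : Vec ℤ n → Maybe (Vec ℕ m)
    search w = List.find (λ x → φmono x ≟ᶻ w) (List.map proj₂ F)

    representative : Vec ℕ m → Vec ℕ m
    representative e = fromMaybe e (search (φmono e))

    φmono-representative : ∀ e → φmono (representative e) ≡ φmono e
    φmono-representative e with search (φmono e) in found
    ... | just x  = find-sound (λ x → φmono x ≟ᶻ φmono e) (List.map proj₂ F) found
    ... | nothing = refl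

    representative-chosen : ∀ t x → t ∈ F → representative (proj₂ t) ≡ x → search (φmono x) ≡ just x
    representative-chosen t x t∈F rep≡x
      rewrite sym rep≡x | φmono-representative (proj₂ t) with search (φmono (proj₂ t)) in found
    ... | just y  = refl
    ... | nothing =
      ⊥-elim (find-complete (λ x → φmono x ≟ᶻ φmono (proj₂ t)) (List.map proj₂ F) (∈-map⁺ proj₂ t∈F) refl found)

    binomials : Poly m → Poly m
    binomials = List.concatMap (λ t → binomialₖ (proj₁ t) (proj₂ t) (representative (proj₂ t)))

    split : ∀ p x → coeff p x ≈ coeff (binomials p) x + coeff (relabel representative p) x
    split []            x = ≈-sym (+-identityˡ 0#)
    split ((a , e) ∷ p) x = begin
      coeff ((a , e) ∷ p) x
        ≈⟨ coefficient-∷ _≟ᴺ_ a e p x ⟩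
      A + coeff p x
        ≈⟨ +-congˡ (split p x) ⟩
      A + (B + R)
        ≈⟨ +-congˡ (+-congʳ (+-identityˡ B)) ⟨
      A + ((0# + B) + R)
        ≈⟨ +-congˡ (+-congʳ (+-congʳ ([]·-cancel β a))) ⟨
      A + ((([ β ]· (- a) + [ β ]· a) + B) + R)
        ≈⟨ regroup A ([ β ]· (- a)) ([ β ]· a) B R ⟩
      (A + ([ β ]· (- a) + B)) + ([ β ]· a + R)
        ≈⟨ +-cong (+-congˡ (coefficient-∷ _≟ᴺ_ (- a) (representative e) (binomials p) x))
                  (coefficient-∷ _≟ᴺ_ a (representative e) (relabel representative p) x) ⟨
      (A + coeff ((- a , representative e) ∷ binomials p) x) + coeff (relabel representative ((a , e) ∷ p)) x
        ≈⟨ +-congʳ (coefficient-∷ _≟ᴺ_ a e ((- a , representative e) ∷ binomials p) x) ⟨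
      coeff (binomials ((a , e) ∷ p)) x + coeff (relabel representative ((a , e) ∷ p)) x ∎
      where
      open SetoidReasoning setoid
      A B R : Carrier
      A = [ ⌊ e ≟ᴺ x ⌋ ]· a
      B = coeff (binomials p) x
      R = coeff (relabel representative p) x
      β : Bool
      β = ⌊ representative e ≟ᴺ x ⌋
      regroup : ∀ A P Q B R → A + (((P + Q) + B) + R) ≈ (A + (P + B)) + (Q + R)
      regroup A P Q B R = begin
        A + (((P + Q) + B) + R) ≈⟨ +-congˡ (+-congʳ (+-assoc P Q B)) ⟩
        A + ((P + (Q + B)) + R) ≈⟨ +-congˡ (+-congʳ (+-congˡ (+-comm Q B))) ⟩
        A + ((P + (B + Q)) + R) ≈⟨ +-congˡ (+-congʳ (+-assoc P B Q)) ⟨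
        A + (((P + B) + Q) + R) ≈⟨ +-congˡ (+-assoc (P + B) Q R) ⟩
        A + ((P + B) + (Q + R)) ≈⟨ +-assoc A (P + B) (Q + R) ⟨
        (A + (P + B)) + (Q + R) ∎

    representatives-vanish : InToricIdeal F → ∀ x → coeff (relabel representative F) x ≈ 0#
    representatives-vanish F∈ker x with Maybeₚ.≡-dec _≟ᴺ_ (search (φmono x)) (just x)
    ... | yes chosen =
      ≈-trans (coefficient-relabel-⇔ _≟ᴺ_ _≟ᶻ_ representative φmono F x (φmono x) same-fibre) (F∈ker (φmono x))
      where
      same-fibre : ∀ e → (representative e ≡ x) ⇔ (φmono e ≡ φmono x)
      same-fibre e = mk⇔ (λ rep≡x → trans (sym (φmono-representative e)) (cong φmono rep≡x))
                         (λ φe≡φx → cong (fromMaybe e) (trans (cong search φe≡φx) chosen))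
    ... | no ¬chosen =
      coefficient-relabel-∉ _≟ᴺ_ representative F x (λ t t∈F rep≡x → ¬chosen (representative-chosen t x t∈F rep≡x))

    binomials∈ideal : ∀ p → InIdeal CycleBinomial (binomials p)
    binomials∈ideal []            = [] , λ _ → ≈-refl
    binomials∈ideal ((a , e) ∷ p) = InIdeal-++ {binomialₖ a e (representative e)} {binomials p}
      (subst (InIdeal CycleBinomial) (cong₂ (binomialₖ a) (zero⊕ e) (zero⊕ (representative e)))
             (binomial∈ideal _ a (Vec.replicate m 0) e (representative e) ℕₚ.≤-refl (sym (φmono-representative e))))
      (binomials∈ideal p)
      where
      zero⊕ : ∀ x → Vec.replicate m 0 ⊕ x ≡ x
      zero⊕ = Vecₚ.zipWith-identityˡ ℕₚ.+-identityˡ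

  kernel⊆ideal : ∀ f → InToricIdeal f → InIdeal CycleBinomial f
  kernel⊆ideal f f∈ker =
    InIdeal-≈ {f} {binomials f}
      (λ x → ≈-trans (split f x) (≈-trans (+-congˡ (representatives-vanish f∈ker x)) (+-identityʳ _)))
      (binomials∈ideal f)
    where open Representatives f

mainTheorem1 : {c ℓ : Level} (K : Field c ℓ) (n m : ℕ) (G : SGraph n m)
               (f : Polys.Poly K m) →
               Toric.InToricIdeal K G f ⇔ Polys.InIdeal K (Toric.CycleBinomial K G) f
mainTheorem1 K n m G f = mk⇔ (KernelInIdeal.kernel⊆ideal K G f) (IdealInKernel.ideal⊆kernel K G f)
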